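{- For every family $\mathcal{F}$ of graphs that contains both a $\mathcal{B}$-graph and a $\mathcal{C}^*$-graph, there exists a graph $G$ with $m(G) \le 1$ that is $2$-list-Ramsey with respect to $\mathcal{F}$.
   Context: $m(G) = \max\{e_H/v_H : H \subseteq G,\ v_H\ge1\}$. $G$ is $2$-list-Ramsey for $\mathcal{F}$ if there is an assignment of lists of $2$ colours to the edges of $G$ such that every colouring from the lists contains a monochromatic copy of a member of $\mathcal{F}$. A broom is a tree obtained from a path of length two by attaching an arbitrary number of leaves (hairs) to one endpoint. A $\mathcal{B}$-graph is a graph each component of which is a subgraph of a broom; a $\mathcal{C}^*$-graph is a graph each component of which is a subgraph of an odd cycle or a star. -}

module Defs where

open import Data.Nat using (ℕ; zero; suc; _+_; _≤_; _<_)
open import Data.Fin using (Fin; toℕ)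
open import Data.Fin.Subset using (Subset; _∈_; ∣_∣)
open import Data.List using (List; length; lookup)
open import Data.List.Relation.Unary.All using (All)
open import Data.List.Relation.Unary.Unique.Propositional using (Unique)
open import Data.List.Relation.Binary.Sublist.Propositional using (_⊆_)
open import Data.Product using (Σ; ∃; _×_; _,_; proj₁; proj₂)
open import Data.Sum using (_⊎_)
open import Relation.Binary.PropositionalEquality using (_≡_; _≢_)
open import Function.Definitions using (Injective)

-- Finite simple graphs on vertex set Fin n.
-- An edge {u,v} is stored once, as the ordered pair (u , v) with u < v;
-- the edge list has no repetitions.

record Graph : Set where
  field
    n        : ℕ
    E        : List (Fin n × Fin n)
    ordered  : All (λ e → toℕ (proj₁ e) < toℕ (proj₂ e)) E
    noDup    : Unique E

open Graph public

v : Graph → ℕ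
v G = n G

e : Graph → ℕ
e G = length (E G)

edge : (G : Graph) → Fin (e G) → Fin (n G) × Fin (n G)
edge G k = lookup (E G) k

Adj : (G : Graph) → Fin (n G) → Fin (n G) → Set
Adj G x y = Σ (Fin (e G)) λ k → (edge G k ≡ (x , y)) ⊎ (edge G k ≡ (y , x))

-- m(G) ≤ 1 : for every subgraph H ⊆ G with v_H ≥ 1, e_H / v_H ≤ 1,
-- i.e. e_H ≤ v_H.  A subgraph is given by a vertex set S and a
-- sub-list F of the edges of G all of whose endpoints lie in S.

mAtMost1 : Graph → Set
mAtMost1 G =
  (S : Subset (n G)) → (F : List (Fin (n G) × Fin (n G))) →
  F ⊆ E G →
  All (λ xy → (proj₁ xy ∈ S) × (proj₂ xy ∈ S)) F →
  1 ≤ ∣ S ∣ →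
  length F ≤ ∣ S ∣

data Reach (H : Graph) (x : Fin (n H)) : Fin (n H) → Set where
  here : Reach H x x
  step : ∀ {y z} → Reach H x y → Adj H y z → Reach H x z

-- "The component of H containing x is a subgraph of the graph whose
-- vertex set is Fin m and adjacency relation is A": there is a map from
-- the component into Fin m, injective on the component, sending every
-- edge of the component to an A-edge.
ComponentEmbeds : (H : Graph) → Fin (n H) →
                  (m : ℕ) → (Fin m → Fin m → Set) → Set
ComponentEmbeds H x m A =
  Σ (Fin (n H) → Fin m) λ φ →
    ((y z : Fin (n H)) → Reach H x y → Reach H x z → φ y ≡ φ z → y ≡ z) ×
    ((y z : Fin (n H)) → Reach H x y → Adj H y z → A (φ y) (φ z))

BroomAdj : (h : ℕ) → Fin (3 + h) → Fin (3 + h) → Set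
BroomAdj h x y =
  (toℕ x ≡ 0 × toℕ y ≡ 1) ⊎ (toℕ x ≡ 1 × toℕ y ≡ 0) ⊎
  (toℕ x ≡ 1 × toℕ y ≡ 2) ⊎ (toℕ x ≡ 2 × toℕ y ≡ 1) ⊎
  (toℕ x ≡ 2 × 3 ≤ toℕ y) ⊎ (3 ≤ toℕ x × toℕ y ≡ 2)

CycleAdj : (k : ℕ) → Fin (3 + (k + k)) → Fin (3 + (k + k)) → Set
CycleAdj k x y =
  (toℕ y ≡ suc (toℕ x)) ⊎ (toℕ x ≡ suc (toℕ y)) ⊎
  (toℕ x ≡ 0 × toℕ y ≡ 2 + (k + k)) ⊎ (toℕ y ≡ 0 × toℕ x ≡ 2 + (k + k))

StarAdj : (k : ℕ) → Fin (1 + k) → Fin (1 + k) → Set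
StarAdj k x y =
  (toℕ x ≡ 0 × toℕ y ≢ 0) ⊎ (toℕ y ≡ 0 × toℕ x ≢ 0)

BGraph : Graph → Set
BGraph H = (x : Fin (n H)) →
  ∃ λ h → ComponentEmbeds H x (3 + h) (BroomAdj h)

CStarGraph : Graph → Set
CStarGraph H = (x : Fin (n H)) →
  (∃ λ k → ComponentEmbeds H x (3 + (k + k)) (CycleAdj k)) ⊎
  (∃ λ k → ComponentEmbeds H x (1 + k) (StarAdj k))

ListAssignment2 : Graph → Set
ListAssignment2 G =
  Σ (Fin (e G) → ℕ × ℕ) λ L → (k : Fin (e G)) → proj₁ (L k) ≢ proj₂ (L k)

FromLists : (G : Graph) → ListAssignment2 G → (Fin (e G) → ℕ) → Set
FromLists G (L , _) χ =
  (k : Fin (e G)) → (χ k ≡ proj₁ (L k)) ⊎ (χ k ≡ proj₂ (L k))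

MonoCopy : (G : Graph) → (Fin (e G) → ℕ) → ℕ → Graph → Set
MonoCopy G χ c H =
  Σ (Fin (n H) → Fin (n G)) λ φ →
    Injective _≡_ _≡_ φ ×
    ((k : Fin (e H)) →
      Σ (Fin (e G)) λ j →
        ((edge G j ≡ (φ (proj₁ (edge H k)) , φ (proj₂ (edge H k)))) ⊎
         (edge G j ≡ (φ (proj₂ (edge H k)) , φ (proj₁ (edge H k))))) ×
        (χ j ≡ c))

ListRamsey2 : Graph → (Graph → Set) → Set
ListRamsey2 G 𝓕 =
  Σ (ListAssignment2 G) λ L →
    (χ : Fin (e G) → ℕ) → FromLists G L χ →
      Σ Graph λ H → 𝓕 H × ∃ λ c → MonoCopy G χ c H

-- The host graph is a disjoint union of unicyclic gadgets, so m(G) ≤ 1.  A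
-- gadget is an odd cycle of length 3 + 2j whose vertices each carry 2(H + 1)
-- pendant vertices, each with P₂ leaves, and all its edges get one list {a, b}.
-- In a colouring from the lists, at every cycle vertex H + 1 pendant edges share
-- a colour.  Comparing these colours with those of the cycle edges yields a
-- monochromatic broom with H hairs, unless the odd cycle is monochromatic and
-- its pendant edges have the other colour; then the leaves of one pendant vertex
-- give either a broom or a star K₁,P₂ in the colour of the cycle.
-- With enough copies of every gadget, either some list {a, b} gives brooms of one
-- colour in as many copies as B has components, and B embeds; or every length j
-- and every list {a, b} give cycles and stars of a single colour w(j, a, b).  In
-- the latter case, with p lengths and p + 1 colours, some colour d wins a game
-- {d, e} in every round j, and C embeds in colour d.

module Submission where

open import Defs
open import Data.Fin using (Fin)
open import Data.Nat using (ℕ; _≤_)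
open import Data.Product using (Σ; ∃; _×_; _,_)
open import Data.Sum using ([_,_])
open import Function.Bundles using (_↔_)
open import Relation.Nullary using (¬_; Dec)

module Counting where

  open import Data.Bool using (Bool; true; false)
  open import Data.Empty using (⊥-elim)
  open import Data.Fin using (Fin; zero; suc; inject≤; toℕ; fromℕ<; inject)
  open import Data.Fin.Properties using (suc-injective; inject≤-injective; ¬∀⟶∃¬-smallest; toℕ-injective; toℕ-inject; toℕ-fromℕ<)
  open import Data.Fin.Subset using (Subset; _∈_; ∣_∣; _-_)
  open import Data.Fin.Subset.Properties using (x∈p⇒∣p-x∣<∣p∣; x∈p∧x≢y⇒x∈p-y)
  open import Data.List using (List; []; _∷_; length; map)
  open import Data.List.Relation.Binary.Sublist.Propositional using (_⊆_; []; _∷_; _∷ʳ_)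
  open import Data.List.Relation.Binary.Sublist.Propositional.Properties using (All-resp-⊆)
  open import Data.List.Relation.Unary.All using (All; []; _∷_)
  import Data.List.Relation.Unary.All as All
  open import Data.List.Relation.Unary.AllPairs using ([]; _∷_)
  open import Data.List.Relation.Unary.Unique.Propositional using (Unique)
  open import Data.Nat using (ℕ; zero; suc; _+_; _≤_; _<_; z≤n; s≤s)
  open import Data.Nat.Properties using (≤-trans; ≤-refl; +-suc; m≤m+n; m≤n+m; <⇒≱; +-mono-<; ≰⇒>; _≤?_; ≮⇒≥)
  open import Data.Product using (Σ; ∃; _×_; _,_; proj₁)
  open import Function using (_∘_)
  open import Function.Definitions using (Injective)
  open import Relation.Binary.PropositionalEquality
  open import Relation.Nullary using (¬_; yes; no)
  open import Relation.Nullary.Decidable using (¬?; decidable-stable)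
  open import Relation.Unary using (Decidable)

  Unique-resp-⊇ : ∀ {A : Set} {xs ys : List A} → xs ⊆ ys → Unique ys → Unique xs
  Unique-resp-⊇ []         []         = []
  Unique-resp-⊇ (_ ∷ʳ τ)   (_ ∷ u)    = Unique-resp-⊇ τ u
  Unique-resp-⊇ (refl ∷ τ) (x∉ys ∷ u) = All-resp-⊆ τ x∉ys ∷ Unique-resp-⊇ τ u

  Unique-map⁺-on : ∀ {A B : Set} (P : A → Set) (f : A → B) →
                   (∀ {x y} → P x → P y → f x ≡ f y → x ≡ y) →
                   ∀ {xs} → Unique xs → All P xs → Unique (map f xs)
  Unique-map⁺-on P f inj [] [] = []
  Unique-map⁺-on P f inj {x ∷ _} (x∉xs ∷ u) (px ∷ ps) =
    distinct x∉xs ps ∷ Unique-map⁺-on P f inj u ps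
    where
    distinct : ∀ {ys} → All (x ≢_) ys → All P ys → All (f x ≢_) (map f ys)
    distinct {ys = []}     []           []         = []
    distinct {ys = _ ∷ ys} (x≢y ∷ x≢ys) (py ∷ pys) = (x≢y ∘ inj px py) ∷ distinct x≢ys pys

  Unique⇒length≤∣S∣ : ∀ {n} (S : Subset n) {xs : List (Fin n)} →
                      Unique xs → All (_∈ S) xs → length xs ≤ ∣ S ∣
  Unique⇒length≤∣S∣ S {[]} _ _ = z≤n
  Unique⇒length≤∣S∣ S {x ∷ xs} (x∉xs ∷ u) (x∈S ∷ xs⊆S) =
    ≤-trans (s≤s (Unique⇒length≤∣S∣ (S - x) u (All.zipWith dropX (x∉xs , xs⊆S))))
            (x∈p⇒∣p-x∣<∣p∣ x∈S)
    where
    dropX : ∀ {y} → x ≢ y × y ∈ S → y ∈ S - x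
    dropX (x≢y , y∈S) = x∈p∧x≢y⇒x∈p-y y∈S (x≢y ∘ sym)

  Injects : ℕ → ℕ → Set
  Injects m N = Σ (Fin m → Fin N) (Injective _≡_ _≡_)

  _∘ᵢ_ : ∀ {k m N} → Injects m N → Injects k m → Injects k N
  (ι , ι-inj) ∘ᵢ (κ , κ-inj) = ι ∘ κ , κ-inj ∘ ι-inj

  inject≤ᵢ : ∀ {m N} → m ≤ N → Injects m N
  inject≤ᵢ m≤N = (λ s → inject≤ s m≤N) , inject≤-injective m≤N m≤N _ _

  MonochromaticPart : ∀ {N} → (Fin N → Bool) → ℕ → Set
  MonochromaticPart {N} f m =
    Σ Bool λ β → Σ (Injects m N) λ (ι , _) → ∀ s → f (ι s) ≡ β

  record Fibres {N} (f : Fin N → Bool) : Set where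
    field
      #true #false : ℕ
      #true+#false : #true + #false ≡ N
      trues        : Injects #true N
      falses       : Injects #false N
      trues-true   : ∀ s → f (proj₁ trues s) ≡ true
      falses-false : ∀ s → f (proj₁ falses s) ≡ false

  private
    extend : ∀ {m N} → Injects m N → Injects (suc m) (suc N)
    extend (ι , ι-inj) = ι⁺ , ι⁺-inj
      where
      ι⁺ : Fin (suc _) → Fin (suc _)
      ι⁺ zero    = zero
      ι⁺ (suc s) = suc (ι s)
      ι⁺-inj : Injective _≡_ _≡_ ι⁺
      ι⁺-inj {zero}  {zero}  _  = refl
      ι⁺-inj {zero}  {suc _} ()
      ι⁺-inj {suc _} {zero}  ()
      ι⁺-inj {suc _} {suc _} eq = cong suc (ι-inj (suc-injective eq))

    shift : ∀ {m N} → Injects m N → Injects m (suc N)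
    shift (ι , ι-inj) = suc ∘ ι , ι-inj ∘ suc-injective

  fibres : ∀ {N} (f : Fin N → Bool) → Fibres f
  fibres {zero} f = record
    { #true = 0 ; #false = 0 ; #true+#false = refl
    ; trues = (λ ()) , λ {} ; falses = (λ ()) , λ {}
    ; trues-true = λ () ; falses-false = λ () }
  fibres {suc N} f with fibres (f ∘ suc) | f zero in f0
  ... | fs | true = record
    { #true = suc #true ; #false = #false ; #true+#false = cong suc #true+#false
    ; trues = extend trues ; falses = shift falses
    ; trues-true = λ { zero → f0 ; (suc s) → trues-true s }
    ; falses-false = falses-false }
    where open Fibres fs
  ... | fs | false = record
    { #true = #true ; #false = suc #false
    ; #true+#false = trans (+-suc #true #false) (cong suc #true+#false)
    ; trues = shift trues ; falses = extend falses
    ; trues-true = trues-true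
    ; falses-false = λ { zero → f0 ; (suc s) → falses-false s } }
    where open Fibres fs

  opaque
    majority : ∀ m {N} → m + m ≤ N → (f : Fin N → Bool) → MonochromaticPart f m
    majority m m+m≤N f with fibres f | m ≤? Fibres.#true (fibres f) | m ≤? Fibres.#false (fibres f)
    ... | fs | yes m≤t | _       = true , trues ∘ᵢ inject≤ᵢ m≤t , λ _ → trues-true _
      where open Fibres fs
    ... | fs | no _    | yes m≤f = false , falses ∘ᵢ inject≤ᵢ m≤f , λ _ → falses-false _
      where open Fibres fs
    ... | fs | no m≰t  | no m≰f  =
      ⊥-elim (<⇒≱ (+-mono-< (≰⇒> m≰t) (≰⇒> m≰f)) (subst (m + m ≤_) (sym #true+#false) m+m≤N))
      where open Fibres fs

  majority² : ∀ m {N} → (m + m) + (m + m) ≤ N → (f g : Fin N → Bool) →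
              Σ Bool λ β → Σ Bool λ γ → Σ (Injects m N) λ (ι , _) → ∀ s → f (ι s) ≡ β × g (ι s) ≡ γ
  majority² m m⁴≤N f g with majority (m + m) m⁴≤N f
  ... | β , ι , fι≡β with majority m ≤-refl (g ∘ proj₁ ι)
  ...   | γ , κ , gικ≡γ = β , γ , ι ∘ᵢ κ , λ s → fι≡β (proj₁ κ s) , gικ≡γ s

  sumᶠ : ∀ {n} → (Fin n → ℕ) → ℕ
  sumᶠ {zero}  f = 0
  sumᶠ {suc n} f = f zero + sumᶠ (f ∘ suc)

  ≤-sumᶠ : ∀ {n} (f : Fin n → ℕ) i → f i ≤ sumᶠ f
  ≤-sumᶠ f zero    = m≤m+n _ _
  ≤-sumᶠ f (suc i) = ≤-trans (≤-sumᶠ (f ∘ suc) i) (m≤n+m _ (f zero))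

  least : ∀ {n} {P : Fin n → Set} → Decidable P → ∃ P →
          Σ (Fin n) λ i → P i × ∀ {j} → P j → toℕ i ≤ toℕ j
  least {n} {P} P? (j , pj) with ¬∀⟶∃¬-smallest n (¬_ ∘ P) (¬? ∘ P?) (λ none → none j pj)
  ... | i , ¬¬pi , before = i , decidable-stable (P? i) ¬¬pi , minimal
    where
    minimal : ∀ {k} → P k → toℕ i ≤ toℕ k
    minimal {k} pk = ≮⇒≥ λ k<i → before (fromℕ< k<i) (subst P (sym (inject-fromℕ< k<i)) pk)
      where
      inject-fromℕ< : (k<i : toℕ k < toℕ i) → inject (fromℕ< k<i) ≡ k
      inject-fromℕ< k<i = toℕ-injective (trans (toℕ-inject (fromℕ< k<i)) (toℕ-fromℕ< k<i))

module Reachability where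

  open import Defs
  open Counting using (least)
  open import Data.Bool using (Bool; T; _∨_; T?)
  open import Data.Bool.Properties using (T-∨)
  open import Data.Fin using (Fin; zero; suc; toℕ; _≟_; _<_)
  open import Data.Fin.Properties using (any?; all?; ¬∀⟶∃¬; pigeonhole; toℕ-injective)
  open import Data.Nat using (ℕ; zero; suc; _≤_; z≤n; s≤s)
  open import Data.Nat.Properties using (≤-refl; ≤-antisym; m≤n⇒m<n∨m≡n)
  open import Data.Product using (Σ; ∃; ∃₂; _×_; _,_; proj₁; proj₂)
  open import Data.Product.Properties using (≡-dec)
  open import Data.Sum using (inj₁; inj₂)
  open import Function using (_∘_)
  open import Function.Definitions using (Injective)
  open import Function.Bundles using (Equivalence)
  open import Relation.Binary.PropositionalEquality
  open import Data.Empty using (⊥-elim)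
  open import Relation.Nullary using (¬_; Dec; yes; no; contradiction; ⌊_⌋)
  open import Relation.Nullary.Decidable using (_×-dec_; _⊎-dec_; _→-dec_; toWitness; fromWitness; decidable-stable)

  adj? : (G : Graph) → ∀ x y → Dec (Adj G x y)
  adj? G x y = any? λ k → ≡-dec _≟_ _≟_ (edge G k) (x , y) ⊎-dec ≡-dec _≟_ _≟_ (edge G k) (y , x)

  Adj-sym : (G : Graph) → ∀ {x y} → Adj G x y → Adj G y x
  Adj-sym G (k , inj₁ p) = k , inj₂ p
  Adj-sym G (k , inj₂ p) = k , inj₁ p

  Reach-trans : (G : Graph) → ∀ {x y z} → Reach G x y → Reach G y z → Reach G x z
  Reach-trans G r here       = r
  Reach-trans G r (step s a) = step (Reach-trans G r s) a

  Adj⇒Reach : (G : Graph) → ∀ {x y} → Adj G x y → Reach G x y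
  Adj⇒Reach G = step here

  Reach-sym : (G : Graph) → ∀ {x y} → Reach G x y → Reach G y x
  Reach-sym G here       = here
  Reach-sym G (step r a) = Reach-trans G (Adj⇒Reach G (Adj-sym G a)) (Reach-sym G r)

  module Search (G : Graph) (x : Fin (n G)) where

    within : ℕ → Fin (n G) → Bool
    extends? : ∀ t y → Dec (∃ λ z → T (within t z) × Adj G z y)

    within zero    y = ⌊ x ≟ y ⌋
    within (suc t) y = within t y ∨ ⌊ extends? t y ⌋

    extends? t y = any? λ z → T? (within t z) ×-dec adj? G z y

    within-step : ∀ t {z y} → T (within t z) → Adj G z y → T (within (suc t) y)
    within-step t {z} {y} xz zy = Equivalence.from T-∨ (inj₂ (fromWitness {a? = extends? t y} (z , xz , zy)))

    within-suc : ∀ t {y} → T (within t y) → T (within (suc t) y)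
    within-suc t xy = Equivalence.from T-∨ (inj₁ xy)

    within-mono : ∀ {t u y} → t ≤ u → T (within t y) → T (within u y)
    within-mono {u = zero}  z≤n xy = xy
    within-mono {u = suc u} t≤u xy with m≤n⇒m<n∨m≡n t≤u
    ... | inj₁ (s≤s t≤u′) = within-suc u (within-mono t≤u′ xy)
    ... | inj₂ refl       = xy

    within-sound : ∀ t {y} → T (within t y) → Reach G x y
    within-sound zero    {y} xy with toWitness {a? = x ≟ y} xy
    ... | refl = here
    within-sound (suc t) {y} xy with Equivalence.to T-∨ xy
    ... | inj₁ xy′ = within-sound t xy′
    ... | inj₂ via with toWitness {a? = extends? t y} via
    ...   | z , xz , zy = step (within-sound t xz) zy

    within-complete : ∀ {y} → Reach G x y → ∃ λ t → T (within t y)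
    within-complete here = 0 , fromWitness {a? = x ≟ x} refl
    within-complete (step r a) with within-complete r
    ... | t , xy = suc t , within-step t xy a

    Stable : ℕ → Set
    Stable t = ∀ y → T (within (suc t) y) → T (within t y)

    stable-closed : ∀ t → Stable t → ∀ u {y} → T (within u y) → T (within t y)
    stable-closed t st zero    xy = within-mono {u = t} z≤n xy
    stable-closed t st (suc u) {y} xy with Equivalence.to T-∨ xy
    ... | inj₁ xy′ = stable-closed t st u xy′
    ... | inj₂ via with toWitness {a? = extends? u y} via
    ...   | z , xz , zy = st y (within-step t (stable-closed t st u xz) zy)

    stable? : ∀ t → Dec (Stable t)
    stable? t = all? λ y → T? (within (suc t) y) →-dec T? (within t y)

    new-vertex : ∀ t → ¬ Stable t → ∃ λ y → T (within (suc t) y) × ¬ T (within t y)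
    new-vertex t ¬st with ¬∀⟶∃¬ _ _ (λ y → T? (within (suc t) y) →-dec T? (within t y)) ¬st
    ... | y , ¬imp = y , decidable-stable (T? _) (λ ¬new → ¬imp (λ new → contradiction new ¬new)) , λ old → ¬imp (λ _ → old)

    -- A search that is unstable at each of the steps 0 … n discovers n + 1
    -- distinct vertices.
    stabilises : ∃ Stable
    stabilises with any? (λ (t : Fin (suc (n G))) → stable? (toℕ t))
    ... | yes (t , st) = toℕ t , st
    ... | no never     = ⊥-elim (collision (pigeonhole ≤-refl (proj₁ ∘ discovered)))
      where
      discovered : ∀ (t : Fin (suc (n G))) → ∃ λ y → T (within (suc (toℕ t)) y) × ¬ T (within (toℕ t) y)
      discovered t = new-vertex (toℕ t) (λ st → never (t , st))
      collision : ¬ ∃₂ λ i j → i < j × proj₁ (discovered i) ≡ proj₁ (discovered j)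
      collision (i , j , i<j , same) =
        proj₂ (proj₂ (discovered j)) (subst (T ∘ within (toℕ j)) same (within-mono i<j (proj₁ (proj₂ (discovered i)))))

    reach? : ∀ y → Dec (Reach G x y)
    reach? y with stabilises
    ... | t , st with T? (within t y)
    ...   | yes xy = yes (within-sound t xy)
    ...   | no ¬xy = no λ r → let (u , xy) = within-complete r in ¬xy (stable-closed t st u xy)

  module Representatives (G : Graph) where

    private
      leastReaching : ∀ y → Σ (Fin (n G)) λ r → Reach G r y × ∀ {x} → Reach G x y → toℕ r ≤ toℕ x
      leastReaching y = least (λ x → Search.reach? G x y) (y , here)

    rep : Fin (n G) → Fin (n G)
    rep y = proj₁ (leastReaching y)

    rep-reaches : ∀ y → Reach G (rep y) y
    rep-reaches y = proj₁ (proj₂ (leastReaching y))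

    rep-const : ∀ {y z} → Reach G y z → rep y ≡ rep z
    rep-const {y} {z} y↝z = toℕ-injective (≤-antisym
      (proj₂ (proj₂ (leastReaching y)) (Reach-trans G (rep-reaches z) (Reach-sym G y↝z)))
      (proj₂ (proj₂ (leastReaching z)) (Reach-trans G (rep-reaches y) y↝z)))

  ComponentEmbeds-∘ : ∀ {G x m m′} {A : Fin m → Fin m → Set} {A′ : Fin m′ → Fin m′ → Set} →
                      ComponentEmbeds G x m A → (f : Fin m → Fin m′) → Injective _≡_ _≡_ f →
                      (∀ {u v} → A u v → A′ (f u) (f v)) → ComponentEmbeds G x m′ A′
  ComponentEmbeds-∘ (φ , φ-inj , φ-adj) f f-inj f-adj =
    f ∘ φ , (λ y z xy xz → φ-inj y z xy xz ∘ f-inj) , (λ y z xy yz → f-adj (φ-adj y z xy yz))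

module Edges where

  open import Defs
  open Counting using (Unique-resp-⊇; Unique-map⁺-on; Unique⇒length≤∣S∣)
  open Reachability using (adj?; Adj-sym)
  open import Data.Empty using (⊥-elim)
  open import Data.Fin using (Fin; zero; suc; toℕ)
  open import Data.Fin.Subset using (∣_∣) renaming (_∈_ to _∈ₛ_)
  open import Data.List using (List; _∷_; lookup)
  open import Data.List.Properties using (length-map)
  open import Data.List.Membership.Propositional using (_∈_)
  open import Data.List.Membership.Propositional.Properties using (∈-lookup)
  open import Data.List.Relation.Binary.Sublist.Propositional.Properties using (All-resp-⊆)
  open import Data.List.Relation.Unary.All using (All; _∷_)
  import Data.List.Relation.Unary.All as All
  import Data.List.Relation.Unary.All.Properties as All
  open import Data.List.Relation.Unary.AllPairs using (_∷_)
  open import Data.List.Relation.Unary.Unique.Propositional using (Unique)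
  open import Data.Nat using (ℕ; _<_; _≤_)
  open import Data.Nat.Properties using (<-asym)
  open import Data.Product using (Σ; _×_; _,_; proj₁; proj₂)
  open import Data.Sum using (_⊎_; inj₁; inj₂)
  open import Function using (id)
  open import Function.Definitions using (Injective)
  open import Relation.Binary.PropositionalEquality
  open import Relation.Nullary using (yes; no)

  lookup-injective : ∀ {A : Set} {xs : List A} → Unique xs → ∀ {i j} → lookup xs i ≡ lookup xs j → i ≡ j
  lookup-injective {xs = _ ∷ _} _          {zero}  {zero}  _  = refl
  lookup-injective {xs = _ ∷ _} (x∉xs ∷ _) {zero}  {suc j} eq = ⊥-elim (All.lookup x∉xs (∈-lookup j) eq)
  lookup-injective {xs = _ ∷ _} (x∉xs ∷ _) {suc i} {zero}  eq = ⊥-elim (All.lookup x∉xs (∈-lookup i) (sym eq))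
  lookup-injective {xs = _ ∷ _} (_ ∷ u)    {suc i} {suc j} eq = cong suc (lookup-injective u eq)

  edge-ordered : (G : Graph) → ∀ k → toℕ (proj₁ (edge G k)) < toℕ (proj₂ (edge G k))
  edge-ordered G k = All.lookup (ordered G) (∈-lookup k)

  edge-injective : (G : Graph) → ∀ {k k′ u v} →
                   (edge G k ≡ (u , v)) ⊎ (edge G k ≡ (v , u)) →
                   (edge G k′ ≡ (v , u)) ⊎ (edge G k′ ≡ (u , v)) → k ≡ k′
  edge-injective G {k} {k′} = same
    where
    reversed : ∀ {i j u v} → edge G i ≡ (u , v) → edge G j ≡ (v , u) → i ≡ j
    reversed {i} {j} refl eq = ⊥-elim (<-asym (edge-ordered G i) (subst (λ e → toℕ (proj₁ e) < toℕ (proj₂ e)) eq (edge-ordered G j)))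
    same : _ → _ → k ≡ k′
    same (inj₁ e) (inj₁ e′) = reversed e e′
    same (inj₁ e) (inj₂ e′) = lookup-injective (noDup G) (trans e (sym e′))
    same (inj₂ e) (inj₁ e′) = lookup-injective (noDup G) (trans e (sym e′))
    same (inj₂ e) (inj₂ e′) = reversed e e′

  module EdgeColouring (G : Graph) (χ : Fin (e G) → ℕ) where

    colour : Fin (n G) → Fin (n G) → ℕ
    colour u v with adj? G u v
    ... | yes (k , _) = χ k
    ... | no _        = 0

    colour-adj : ∀ {u v} → Adj G u v →
                 Σ (Fin (e G)) λ j → ((edge G j ≡ (u , v)) ⊎ (edge G j ≡ (v , u))) × χ j ≡ colour u v
    colour-adj {u} {v} uv with adj? G u v
    ... | yes (k , uv′) = k , uv′ , refl
    ... | no ¬uv        = ⊥-elim (¬uv uv)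

    colour-sym : ∀ u v → colour u v ≡ colour v u
    colour-sym u v with adj? G u v | adj? G v u
    ... | yes (k , o) | yes (k′ , o′) = cong χ (edge-injective G o o′)
    ... | yes uv      | no ¬vu        = ⊥-elim (¬vu (Adj-sym G uv))
    ... | no ¬uv      | yes vu        = ⊥-elim (¬uv (Adj-sym G vu))
    ... | no _        | no _          = refl

    monoCopy : (H : Graph) (c : ℕ) (Φ : Fin (n H) → Fin (n G)) → Injective _≡_ _≡_ Φ →
               (∀ {y z} → Adj H y z → Adj G (Φ y) (Φ z) × colour (Φ y) (Φ z) ≡ c) →
               MonoCopy G χ c H
    monoCopy H c Φ Φ-inj Φ-adj = Φ , Φ-inj , copyEdge
      where
      copyEdge : ∀ k → _
      copyEdge k with Φ-adj (k , inj₁ refl)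
      ... | adj , c-adj with colour-adj adj
      ...   | j , oriented , χj = j , oriented , trans χj c-adj

  edge-owner⇒mAtMost1 : (G : Graph) (owner : Fin (n G) × Fin (n G) → Fin (n G)) →
    (∀ {uv} → uv ∈ E G → (owner uv ≡ proj₁ uv) ⊎ (owner uv ≡ proj₂ uv)) →
    (∀ {uv uv′} → uv ∈ E G → uv′ ∈ E G → owner uv ≡ owner uv′ → uv ≡ uv′) →
    mAtMost1 G
  edge-owner⇒mAtMost1 G owner owner-end owner-inj S F F⊆E F⊆S _ =
    subst (_≤ ∣ S ∣) (length-map owner F)
      (Unique⇒length≤∣S∣ S (Unique-map⁺-on (_∈ E G) owner owner-inj (Unique-resp-⊇ F⊆E (noDup G)) F∈E)
                          (All.map⁺ (All.zipWith ownerIn (F∈E , F⊆S))))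
    where
    F∈E : All (_∈ E G) F
    F∈E = All-resp-⊆ F⊆E (All.tabulate id)
    ownerIn : ∀ {uv} → uv ∈ E G × (proj₁ uv ∈ₛ S) × (proj₂ uv ∈ₛ S) → owner uv ∈ₛ S
    ownerIn (uv∈E , u∈S , v∈S) with owner-end uv∈E
    ... | inj₁ eq = subst (_∈ₛ S) (sym eq) u∈S
    ... | inj₂ eq = subst (_∈ₛ S) (sym eq) v∈S

module FiniteGraph {V : Set} {N : ℕ} (enum : Fin N ↔ V)
                   (_~_ : V → V → Set) (_~?_ : ∀ a b → Dec (a ~ b))
                   (~-sym : ∀ {a b} → a ~ b → b ~ a) (~-irrefl : ∀ {a} → ¬ a ~ a) where

  open import Defs
  open Edges using (module EdgeColouring; edge-owner⇒mAtMost1)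
  open Reachability using (module Representatives; Adj⇒Reach; Adj-sym)
  open import Data.List.Relation.Unary.Any as Any using ()
  open import Data.List.Relation.Unary.Any.Properties using (lookup-index)
  open import Data.Empty using (⊥-elim)
  open import Data.Fin using (toℕ; zero; suc)
  open import Data.Fin.Properties using (toℕ-injective; toℕ<n)
  open import Data.List using (List; filter; cartesianProduct; allFin; lookup)
  open import Data.List.Membership.Propositional using (_∈_)
  open import Data.List.Membership.Propositional.Properties using (∈-filter⁺; ∈-filter⁻; ∈-cartesianProduct⁺; ∈-allFin; ∈-lookup)
  import Data.List.Relation.Unary.All as All
  open import Data.List.Relation.Unary.All.Properties using (all-filter)
  import Data.List.Relation.Unary.Unique.Propositional.Properties as Unique
  open import Data.Nat using (_<_; _≤_; _+_; s≤s; z≤n)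
  open import Data.Nat.Properties using (<-cmp; <-asym; _<?_; ≤-trans)
  open import Data.Product using (Σ; _×_; _,_; proj₁; proj₂)
  import Data.Product
  open import Data.Sum using (_⊎_; inj₁; inj₂)
  import Data.Sum as Sum
  open import Function using (_∘_)
  open import Function.Bundles using (Inverse)
  open import Function.Definitions using (Injective)
  open import Relation.Binary.Definitions using (tri<; tri≈; tri>)
  open import Relation.Binary.PropositionalEquality
  open import Relation.Nullary.Decidable using (_×-dec_)
  open import Relation.Nullary using (yes; no; contradiction)
  open import Data.Fin using (_≟_)

  -- Kept opaque: unfolding the enumeration of a large vertex type is costly.
  opaque
    label : Fin N → V
    label = Inverse.to enum

    index : V → Fin N
    index = Inverse.from enum

    label-index : ∀ a → label (index a) ≡ a
    label-index = Inverse.strictlyInverseˡ enum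

    index-label : ∀ u → index (label u) ≡ u
    index-label = Inverse.strictlyInverseʳ enum

  index-injective : Injective _≡_ _≡_ index
  index-injective {a} {b} eq = trans (sym (label-index a)) (trans (cong label eq) (label-index b))

  private
    OrderedEdge : Fin N × Fin N → Set
    OrderedEdge (u , v) = toℕ u < toℕ v × label u ~ label v

    orderedEdge? : ∀ uv → Dec (OrderedEdge uv)
    orderedEdge? (u , v) = (toℕ u <? toℕ v) ×-dec (label u ~? label v)

    allPairs : List (Fin N × Fin N)
    allPairs = cartesianProduct (allFin N) (allFin N)

  graph : Graph
  graph = record
    { n       = N
    ; E       = filter orderedEdge? allPairs
    ; ordered = All.map proj₁ (all-filter orderedEdge? allPairs)
    ; noDup   = Unique.filter⁺ orderedEdge? (Unique.cartesianProduct⁺ (Unique.allFin⁺ N) (Unique.allFin⁺ N))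
    }

  1≤n-graph : V → 1 ≤ n graph
  1≤n-graph a = ≤-trans (s≤s z≤n) (toℕ<n (index a))

  edge-related : ∀ {uv} → uv ∈ E graph → label (proj₁ uv) ~ label (proj₂ uv)
  edge-related uv∈E = proj₂ (proj₂ (∈-filter⁻ orderedEdge? {xs = allPairs} uv∈E))

  private
    ordered⇒Adj : ∀ {u v} → toℕ u < toℕ v → label u ~ label v → Adj graph u v
    ordered⇒Adj u<v uv = Any.index uv∈E , inj₁ (sym (lookup-index uv∈E))
      where
      uv∈E = ∈-filter⁺ orderedEdge? (∈-cartesianProduct⁺ (∈-allFin _) (∈-allFin _)) (u<v , uv)

  ~⇒Adj : ∀ {a b} → a ~ b → Adj graph (index a) (index b)
  ~⇒Adj {a} {b} a~b with <-cmp (toℕ (index a)) (toℕ (index b))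
  ... | tri< a<b _ _ = ordered⇒Adj a<b (subst₂ _~_ (sym (label-index a)) (sym (label-index b)) a~b)
  ... | tri≈ _ a≡b _ = ⊥-elim (~-irrefl (subst (a ~_) (sym (index-injective (toℕ-injective a≡b))) a~b))
  ... | tri> _ _ b<a = Adj-sym graph (ordered⇒Adj b<a (subst₂ _~_ (sym (label-index b)) (sym (label-index a)) (~-sym a~b)))

  -- If every edge joins a vertex to its parent, the edges are determined by
  -- distinct vertices, so m(graph) ≤ 1.
  module _ (parent : V → V) (edge-to-parent : ∀ {a b} → a ~ b → parent a ≡ b ⊎ parent b ≡ a) where

    graph-mAtMost1 : mAtMost1 graph
    graph-mAtMost1 = edge-owner⇒mAtMost1 graph owner owner-end owner-injective
      where
      parentⁱ : Fin N → Fin N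
      parentⁱ u = index (parent (label u))

      to-parent : ∀ {u v} → (u , v) ∈ E graph → parentⁱ u ≡ v ⊎ parentⁱ v ≡ u
      to-parent {u} {v} uv∈E with edge-to-parent (edge-related uv∈E)
      ... | inj₁ eq = inj₁ (trans (cong index eq) (index-label v))
      ... | inj₂ eq = inj₂ (trans (cong index eq) (index-label u))

      owner : Fin N × Fin N → Fin N
      owner (u , v) with parentⁱ u ≟ v
      ... | yes _ = u
      ... | no _  = v

      owner-end : ∀ {uv} → uv ∈ E graph → (owner uv ≡ proj₁ uv) ⊎ (owner uv ≡ proj₂ uv)
      owner-end {u , v} _ with parentⁱ u ≟ v
      ... | yes _ = inj₁ refl
      ... | no _  = inj₂ refl

      owned : ∀ {u v} → (u , v) ∈ E graph →
              (owner (u , v) ≡ u × parentⁱ u ≡ v) ⊎ (owner (u , v) ≡ v × parentⁱ v ≡ u)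
      owned {u} {v} uv∈E with parentⁱ u ≟ v | to-parent uv∈E
      ... | yes up≡v | _        = inj₁ (refl , up≡v)
      ... | no up≢v  | inj₁ eq  = contradiction eq up≢v
      ... | no _     | inj₂ eq  = inj₂ (refl , eq)

      reversed : ∀ {A : Set} {u v u′ v′} → (u , v) ∈ E graph → (u′ , v′) ∈ E graph → u ≡ v′ → v ≡ u′ → A
      reversed uv∈E uv′∈E refl refl = ⊥-elim (<-asym (All.lookup (ordered graph) uv∈E) (All.lookup (ordered graph) uv′∈E))

      owner-injective : ∀ {uv uv′} → uv ∈ E graph → uv′ ∈ E graph → owner uv ≡ owner uv′ → uv ≡ uv′
      owner-injective {u , v} {u′ , v′} uv∈E uv′∈E eq with owned uv∈E | owned uv′∈E
      ... | inj₁ (o≡u , pu) | inj₁ (o′≡u′ , pu′) = cong₂ _,_ u≡u′ (trans (sym pu) (trans (cong parentⁱ u≡u′) pu′))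
        where u≡u′ = trans (sym o≡u) (trans eq o′≡u′)
      ... | inj₂ (o≡v , pv) | inj₂ (o′≡v′ , pv′) = cong₂ _,_ (trans (sym pv) (trans (cong parentⁱ v≡v′) pv′)) v≡v′
        where v≡v′ = trans (sym o≡v) (trans eq o′≡v′)
      ... | inj₁ (o≡u , pu) | inj₂ (o′≡v′ , pv′) =
        reversed uv∈E uv′∈E u≡v′ (trans (sym pu) (trans (cong parentⁱ u≡v′) pv′))
        where u≡v′ = trans (sym o≡u) (trans eq o′≡v′)
      ... | inj₂ (o≡v , pv) | inj₁ (o′≡u′ , pu′) =
        reversed uv∈E uv′∈E (trans (sym pv) (trans (cong parentⁱ v≡u′) pu′)) v≡u′
        where v≡u′ = trans (sym o≡v) (trans eq o′≡u′)

  listAssignment : (palette : V → ℕ × ℕ) → (∀ {a b} → a ~ b → proj₁ (palette a) ≢ proj₂ (palette a)) →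
                   ListAssignment2 graph
  listAssignment palette distinct =
    (λ k → palette (label (proj₁ (edge graph k)))) , λ k → distinct (edge-related (∈-lookup k))

  module Coloured (χ : Fin (e graph) → ℕ) where

    open EdgeColouring graph χ

    colourᵥ : V → V → ℕ
    colourᵥ a b = colour (index a) (index b)

    colourᵥ-sym : ∀ a b → colourᵥ a b ≡ colourᵥ b a
    colourᵥ-sym a b = colour-sym (index a) (index b)

    colour-in-palette : (palette : V → ℕ × ℕ) (distinct : ∀ {a b} → a ~ b → proj₁ (palette a) ≢ proj₂ (palette a)) →
                        (∀ {a b} → a ~ b → palette a ≡ palette b) → FromLists graph (listAssignment palette distinct) χ →
                        ∀ {a b} → a ~ b → (colourᵥ a b ≡ proj₁ (palette a)) ⊎ (colourᵥ a b ≡ proj₂ (palette a))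
    colour-in-palette palette distinct palette-edge fromLists {a} {b} a~b with colour-adj (~⇒Adj a~b)
    ... | j , oriented , χj≡ = Sum.map (λ eq → trans (sym χj≡) (trans eq (cong proj₁ (listIsPalette oriented))))
                                       (λ eq → trans (sym χj≡) (trans eq (cong proj₂ (listIsPalette oriented))))
                                       (fromLists j)
      where
      listIsPalette : ∀ {j} → (edge graph j ≡ (index a , index b)) ⊎ (edge graph j ≡ (index b , index a)) →
                      palette (label (proj₁ (edge graph j))) ≡ palette a
      listIsPalette (inj₁ eq) = trans (cong (palette ∘ label ∘ proj₁) eq) (cong palette (label-index a))
      listIsPalette (inj₂ eq) = trans (cong (palette ∘ label ∘ proj₁) eq) (trans (cong palette (label-index b)) (sym (palette-edge a~b)))

    Copy : (V → Set) → ℕ → (m : ℕ) → (Fin m → Fin m → Set) → Set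
    Copy P c m A = Σ (Fin m → V) λ ψ → Injective _≡_ _≡_ ψ ×
                     (∀ {u v} → A u v → ψ u ~ ψ v × colourᵥ (ψ u) (ψ v) ≡ c) × (∀ u → P (ψ u))

    ComponentCopy : (H : Graph) → Fin (n H) → (V → Set) → ℕ → Set
    ComponentCopy H x P c = Σ (Fin (n H) → V) λ F →
      (∀ {y z} → Reach H x y → Reach H x z → F y ≡ F z → y ≡ z) ×
      (∀ {y z} → Reach H x y → Adj H y z → F y ~ F z × colourᵥ (F y) (F z) ≡ c) × (∀ y → P (F y))

    copy-component : ∀ {H x m A P c} → ComponentEmbeds H x m A → Copy P c m A → ComponentCopy H x P c
    copy-component (φ , φ-inj , φ-adj) (ψ , ψ-inj , ψ-adj , ψ-P) =
      ψ ∘ φ , (λ ry rz → φ-inj _ _ ry rz ∘ ψ-inj) , (λ ry yz → ψ-adj (φ-adj _ _ ry yz)) , ψ-P ∘ φ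

    assemble : (H : Graph) (c : ℕ) {I : Set} (region : V → I) (γ : Fin (n H) → I) → Injective _≡_ _≡_ γ →
               (∀ x → ComponentCopy H x (λ v → region v ≡ γ x) c) → MonoCopy graph χ c H
    assemble H c region γ γ-inj copies = monoCopy H c Φ Φ-injective Φ-adj
      where
      open Representatives H

      F : Fin (n H) → Fin (n H) → V
      F x = proj₁ (copies x)

      F-injective : ∀ x {y z} → Reach H x y → Reach H x z → F x y ≡ F x z → y ≡ z
      F-injective x = proj₁ (proj₂ (copies x))

      F-adj : ∀ x {y z} → Reach H x y → Adj H y z → F x y ~ F x z × colourᵥ (F x y) (F x z) ≡ c
      F-adj x = proj₁ (proj₂ (proj₂ (copies x)))

      F-region : ∀ x y → region (F x y) ≡ γ x
      F-region x = proj₂ (proj₂ (proj₂ (copies x)))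

      Φ : Fin (n H) → Fin N
      Φ y = index (F (rep y) y)

      Φ-injective : Injective _≡_ _≡_ Φ
      Φ-injective {y} {z} eq = F-injective (rep y) (rep-reaches y) z-reached same-copy
        where
        same-image : F (rep y) y ≡ F (rep z) z
        same-image = index-injective eq
        same-rep : rep y ≡ rep z
        same-rep = γ-inj (trans (sym (F-region (rep y) y)) (trans (cong region same-image) (F-region (rep z) z)))
        z-reached : Reach H (rep y) z
        z-reached = subst (λ r → Reach H r z) (sym same-rep) (rep-reaches z)
        same-copy : F (rep y) y ≡ F (rep y) z
        same-copy = trans same-image (cong (λ r → F r z) (sym same-rep))

      Φ-adj : ∀ {y z} → Adj H y z → Adj graph (Φ y) (Φ z) × colour (Φ y) (Φ z) ≡ c
      Φ-adj {y} {z} yz = subst (λ r → Adj graph (Φ y) (index (F r z)) × colour (Φ y) (index (F r z)) ≡ c)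
                               (rep-const (Adj⇒Reach H yz))
                               (Data.Product.map₁ ~⇒Adj (F-adj (rep y) (rep-reaches y) yz))

    ~⇒≢ : ∀ {a b} → a ~ b → a ≢ b
    ~⇒≢ a~b refl = ~-irrefl a~b

    record Broom (P : V → Set) (c h : ℕ) : Set where
      field
        tip handle centre : V
        hair              : Fin h → V
        tip~handle        : tip ~ handle
        handle~centre     : handle ~ centre
        centre~hair       : ∀ s → centre ~ hair s
        tip-colour        : colourᵥ tip handle ≡ c
        handle-colour     : colourᵥ handle centre ≡ c
        hair-colour       : ∀ s → colourᵥ centre (hair s) ≡ c
        tip-in            : P tip
        handle-in         : P handle
        centre-in         : P centre
        hair-in           : ∀ s → P (hair s)
        tip≢centre        : tip ≢ centre
        hair-injective    : Injective _≡_ _≡_ hair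
        hair≢tip          : ∀ s → hair s ≢ tip
        hair≢handle       : ∀ s → hair s ≢ handle

    broom-copy : ∀ {P c h} → Broom P c h → Copy P c (3 + h) (BroomAdj h)
    broom-copy {P} {c} {h} B = ψ , ψ-injective , ψ-adj , ψ-in
      where
      open Broom B
      ψ : Fin (3 + h) → V
      ψ zero                = tip
      ψ (suc zero)          = handle
      ψ (suc (suc zero))    = centre
      ψ (suc (suc (suc s))) = hair s

      ψ-in : ∀ u → P (ψ u)
      ψ-in zero                = tip-in
      ψ-in (suc zero)          = handle-in
      ψ-in (suc (suc zero))    = centre-in
      ψ-in (suc (suc (suc s))) = hair-in s

      ψ-injective : Injective _≡_ _≡_ ψ
      ψ-injective {zero}                {zero}                _  = refl
      ψ-injective {zero}                {suc zero}            eq = contradiction eq (~⇒≢ tip~handle)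
      ψ-injective {zero}                {suc (suc zero)}      eq = contradiction eq tip≢centre
      ψ-injective {zero}                {suc (suc (suc s))}   eq = contradiction (sym eq) (hair≢tip s)
      ψ-injective {suc zero}            {zero}                eq = contradiction (sym eq) (~⇒≢ tip~handle)
      ψ-injective {suc zero}            {suc zero}            _  = refl
      ψ-injective {suc zero}            {suc (suc zero)}      eq = contradiction eq (~⇒≢ handle~centre)
      ψ-injective {suc zero}            {suc (suc (suc s))}   eq = contradiction (sym eq) (hair≢handle s)
      ψ-injective {suc (suc zero)}      {zero}                eq = contradiction (sym eq) tip≢centre
      ψ-injective {suc (suc zero)}      {suc zero}            eq = contradiction (sym eq) (~⇒≢ handle~centre)
      ψ-injective {suc (suc zero)}      {suc (suc zero)}      _  = refl
      ψ-injective {suc (suc zero)}      {suc (suc (suc s))}   eq = contradiction eq (~⇒≢ (centre~hair s))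
      ψ-injective {suc (suc (suc s))}   {zero}                eq = contradiction eq (hair≢tip s)
      ψ-injective {suc (suc (suc s))}   {suc zero}            eq = contradiction eq (hair≢handle s)
      ψ-injective {suc (suc (suc s))}   {suc (suc zero)}      eq = contradiction (sym eq) (~⇒≢ (centre~hair s))
      ψ-injective {suc (suc (suc s))}   {suc (suc (suc s′))}  eq = cong (λ s → suc (suc (suc s))) (hair-injective eq)

      Edge : Fin (3 + h) → Fin (3 + h) → Set
      Edge u v = ψ u ~ ψ v × colourᵥ (ψ u) (ψ v) ≡ c

      flipped : ∀ u v → Edge u v → Edge v u
      flipped u v (uv , col) = ~-sym uv , trans (colourᵥ-sym (ψ v) (ψ u)) col

      hair-at : ∀ v → 3 ≤ toℕ v → Edge (suc (suc zero)) v
      hair-at (suc (suc (suc s))) _                   = centre~hair s , hair-colour s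
      hair-at zero                ()
      hair-at (suc zero)          (s≤s ())
      hair-at (suc (suc zero))    (s≤s (s≤s ()))

      at : ∀ {u} (i : Fin (3 + h)) → toℕ u ≡ toℕ i → u ≡ i
      at i = toℕ-injective

      ψ-adj : ∀ {u v} → BroomAdj h u v → Edge u v
      ψ-adj (inj₁ (u≡0 , v≡1)) rewrite at zero u≡0 | at (suc zero) v≡1 = tip~handle , tip-colour
      ψ-adj (inj₂ (inj₁ (u≡1 , v≡0))) rewrite at (suc zero) u≡1 | at zero v≡0 =
        flipped zero (suc zero) (tip~handle , tip-colour)
      ψ-adj (inj₂ (inj₂ (inj₁ (u≡1 , v≡2)))) rewrite at (suc zero) u≡1 | at (suc (suc zero)) v≡2 =
        handle~centre , handle-colour
      ψ-adj (inj₂ (inj₂ (inj₂ (inj₁ (u≡2 , v≡1))))) rewrite at (suc (suc zero)) u≡2 | at (suc zero) v≡1 =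
        flipped (suc zero) (suc (suc zero)) (handle~centre , handle-colour)
      ψ-adj {v = v} (inj₂ (inj₂ (inj₂ (inj₂ (inj₁ (u≡2 , 3≤v)))))) rewrite at (suc (suc zero)) u≡2 = hair-at v 3≤v
      ψ-adj {u = u} (inj₂ (inj₂ (inj₂ (inj₂ (inj₂ (3≤u , v≡2)))))) rewrite at (suc (suc zero)) v≡2 =
        flipped (suc (suc zero)) u (hair-at u 3≤u)

    star-copy : ∀ {P c m} (centre : V) (leaf : Fin m → V) → Injective _≡_ _≡_ leaf →
                (∀ s → centre ~ leaf s) → (∀ s → colourᵥ centre (leaf s) ≡ c) →
                P centre → (∀ s → P (leaf s)) → Copy P c (1 + m) (StarAdj m)
    star-copy {P} {c} {m} centre leaf leaf-injective centre~leaf leaf-colour centre-in leaf-in =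
      ψ , ψ-injective , ψ-adj , ψ-in
      where
      ψ : Fin (1 + m) → V
      ψ zero    = centre
      ψ (suc s) = leaf s

      ψ-in : ∀ u → P (ψ u)
      ψ-in zero    = centre-in
      ψ-in (suc s) = leaf-in s

      ψ-injective : Injective _≡_ _≡_ ψ
      ψ-injective {zero}  {zero}   _  = refl
      ψ-injective {zero}  {suc s}  eq = contradiction eq (~⇒≢ (centre~leaf s))
      ψ-injective {suc s} {zero}   eq = contradiction (sym eq) (~⇒≢ (centre~leaf s))
      ψ-injective {suc s} {suc s′} eq = cong suc (leaf-injective eq)

      spoke : ∀ v → toℕ v ≢ 0 → ψ zero ~ ψ v × colourᵥ (ψ zero) (ψ v) ≡ c
      spoke zero    v≢0 = contradiction refl v≢0
      spoke (suc s) _   = centre~leaf s , leaf-colour s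

      ψ-adj : ∀ {u v} → StarAdj m u v → ψ u ~ ψ v × colourᵥ (ψ u) (ψ v) ≡ c
      ψ-adj {v = v} (inj₁ (u≡0 , v≢0)) rewrite toℕ-injective {j = zero} u≡0 = spoke v v≢0
      ψ-adj {u = u} (inj₂ (v≡0 , u≢0)) rewrite toℕ-injective {j = zero} v≡0 with spoke u u≢0
      ... | centre~u , col = ~-sym centre~u , trans (colourᵥ-sym (ψ u) centre) col

    cycle-copy : ∀ {P c} k (w : ℕ → V) → (∀ n → w (n + (3 + (k + k))) ≡ w n) →
                 (∀ {x y} → x < 3 + (k + k) → y < 3 + (k + k) → w x ≡ w y → x ≡ y) →
                 (∀ n → w n ~ w (1 + n)) → (∀ n → colourᵥ (w n) (w (1 + n)) ≡ c) → (∀ n → P (w n)) →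
                 Copy P c (3 + (k + k)) (CycleAdj k)
    cycle-copy {P} {c} k w w-periodic w-injective w-step w-colour w-in =
      w ∘ toℕ , (λ eq → toℕ-injective (w-injective (toℕ<n _) (toℕ<n _) eq)) , ψ-adj , w-in ∘ toℕ
      where
      Edge : V → V → Set
      Edge a b = a ~ b × colourᵥ a b ≡ c

      Step : ℕ → ℕ → Set
      Step x y = Edge (w x) (w y)

      forward : ∀ n → Step n (1 + n)
      forward n = w-step n , w-colour n

      backward : ∀ n → Step (1 + n) n
      backward n = ~-sym (w-step n) , trans (colourᵥ-sym (w (1 + n)) (w n)) (w-colour n)

      ψ-adj : ∀ {u v} → CycleAdj k u v → Step (toℕ u) (toℕ v)
      ψ-adj {u} (inj₁ v≡1+u) = subst (Step (toℕ u)) (sym v≡1+u) (forward (toℕ u))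
      ψ-adj {v = v} (inj₂ (inj₁ u≡1+v)) = subst (λ x → Step x (toℕ v)) (sym u≡1+v) (backward (toℕ v))
      ψ-adj (inj₂ (inj₂ (inj₁ (u≡0 , v≡top)))) rewrite u≡0 | v≡top =
        subst (λ a → Edge a (w (2 + (k + k)))) (w-periodic 0) (backward (2 + (k + k)))
      ψ-adj (inj₂ (inj₂ (inj₂ (v≡0 , u≡top)))) rewrite v≡0 | u≡top =
        subst (Edge (w (2 + (k + k)))) (w-periodic 0) (forward (2 + (k + k)))

module OddCycles where

  open import Data.Bool using (Bool; not) renaming (_≟_ to _≟ᵇ_)
  open import Data.Bool.Properties using (not-involutive; not-¬; ¬-not)
  open import Data.Fin using (Fin; toℕ; fromℕ<)
  open import Data.Fin.Properties using (any?; toℕ-fromℕ<)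
  open import Data.Nat using (ℕ; zero; suc; _+_; _*_; _≤_; _<_; z≤n; s≤s; _%_; _/_)
  open import Data.Nat.DivMod using (m≡m%n+[m/n]*n; m%n<n)
  open import Data.Nat.Properties using (+-identityʳ; +-suc; +-assoc; +-comm; n<1+n; m≤n⇒m<n∨m≡n; <⇒≤)
  open import Data.Product using (∃; _×_; _,_; proj₁; proj₂)
  import Data.Product as Product
  open import Data.Sum using (_⊎_; inj₁; inj₂)
  import Data.Sum as Sum
  open import Relation.Binary.PropositionalEquality
  open import Relation.Nullary using (¬_; Dec; yes; no)
  open import Relation.Nullary.Decidable using (_×-dec_; _⊎-dec_)

  flips : ℕ → Bool → Bool
  flips zero    b = b
  flips (suc t) b = not (flips t b)

  flips-odd : ∀ k b → flips (suc (k + k)) b ≡ not b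
  flips-odd zero    b = refl
  flips-odd (suc k) b = begin
    flips (suc (suc k + suc k)) b     ≡⟨ cong (λ t → flips (suc (suc t)) b) (+-suc k k) ⟩
    not (not (flips (suc (k + k)) b)) ≡⟨ not-involutive _ ⟩
    flips (suc (k + k)) b             ≡⟨ flips-odd k b ⟩
    not b                             ∎
    where open ≡-Reasoning

  -- A cycle of odd length L = 3 + 2k through the positions n mod L; cyc n is the
  -- colour of the cycle edge from n to n + 1, and pen n a colour that occurs on
  -- many pendant edges at n.
  module OddCycleColouring (k : ℕ) (cyc pen : ℕ → Bool)
                           (cyc-periodic : ∀ n → cyc (n + (3 + (k + k))) ≡ cyc n)
                           (pen-periodic : ∀ n → pen (n + (3 + (k + k))) ≡ pen n) where

    L : ℕ
    L = 3 + (k + k)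

    -- a monochromatic broom centred at n: hairs pendant at n, handle n, n + 1
    -- and then a pendant edge at n + 1 or the cycle edge to n + 2
    ForwardBroom : ℕ → Set
    ForwardBroom n = cyc n ≡ pen n × (pen (suc n) ≡ cyc n ⊎ cyc (suc n) ≡ cyc n)

    -- a monochromatic broom centred at n + 2: handle n + 2, n + 1 and then a
    -- pendant edge at n + 1 or the cycle edge to n
    BackwardBroom : ℕ → Set
    BackwardBroom n = cyc (suc n) ≡ pen (2 + n) × (pen (suc n) ≡ cyc (suc n) ⊎ cyc n ≡ cyc (suc n))

    Alternates : ℕ → Set
    Alternates n = cyc (suc n) ≡ not (cyc n)

    alternation : ∀ n T → (∀ t → t < T → Alternates (n + t)) → cyc (n + T) ≡ flips T (cyc n)
    alternation n zero    _   = cong cyc (+-identityʳ n)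
    alternation n (suc T) alt = begin
      cyc (n + suc T)       ≡⟨ cong cyc (+-suc n T) ⟩
      cyc (suc (n + T))     ≡⟨ alt T (n<1+n T) ⟩
      not (cyc (n + T))     ≡⟨ cong not (alternation n T (λ t t<T → alt t (<⇒≤ (s≤s t<T)))) ⟩
      not (flips T (cyc n)) ∎
      where open ≡-Reasoning

    no-odd-alternation : ∀ n → ¬ (∀ t → t < L → Alternates (n + t))
    no-odd-alternation n alt = not-¬ refl (begin
      cyc n                                  ≡⟨ sym (cyc-periodic n) ⟩
      cyc (n + L)                            ≡⟨ alternation n L alt ⟩
      not (not (flips (suc (k + k)) (cyc n))) ≡⟨ not-involutive _ ⟩
      flips (suc (k + k)) (cyc n)            ≡⟨ flips-odd k (cyc n) ⟩
      not (cyc n)                            ∎)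
      where open ≡-Reasoning

    module WithoutBrooms (noForward : ∀ n → ¬ ForwardBroom n) (noBackward : ∀ n → ¬ BackwardBroom n) where

      forward-step : ∀ {n} → cyc n ≡ pen n → Alternates n × cyc (suc n) ≡ pen (suc n)
      forward-step {n} c≡p = alt , trans alt (sym (¬-not λ p≡c → noForward n (c≡p , inj₁ p≡c)))
        where
        alt : Alternates n
        alt = ¬-not λ c≡c → noForward n (c≡p , inj₂ c≡c)

      pen-opposite : ∀ n → pen n ≡ not (cyc n)
      pen-opposite n = ¬-not λ p≡c → no-odd-alternation n (λ t _ → proj₁ (forward-step (agree (sym p≡c) t)))
        where
        agree : cyc n ≡ pen n → ∀ t → cyc (n + t) ≡ pen (n + t)
        agree c≡p zero    = subst (λ m → cyc m ≡ pen m) (sym (+-identityʳ n)) c≡p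
        agree c≡p (suc t) = subst (λ m → cyc m ≡ pen m) (sym (+-suc n t)) (proj₂ (forward-step (agree c≡p t)))

      backward-step : ∀ {n} → Alternates (suc n) → Alternates n
      backward-step {n} alt = ¬-not λ c≡c → noBackward n (c≡p , inj₂ (sym c≡c))
        where
        c≡p : cyc (suc n) ≡ pen (2 + n)
        c≡p = trans (sym (not-involutive _)) (trans (cong not (sym alt)) (sym (pen-opposite (2 + n))))

      -- Alternation propagates backwards, so a single change of colour would
      -- make the whole odd cycle alternate.
      cyc-step : ∀ n → cyc (suc n) ≡ cyc n
      cyc-step n = trans (¬-not changes) (not-involutive (cyc n))
        where
        alternates-below : ∀ t s → s ≤ t → Alternates (n + t) → Alternates (n + s)
        alternates-below zero    .zero z≤n alt = alt
        alternates-below (suc t) s s≤1+t alt with m≤n⇒m<n∨m≡n s≤1+t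
        ... | inj₂ refl      = alt
        ... | inj₁ (s≤s s≤t) = alternates-below t s s≤t (backward-step (subst Alternates (+-suc n t) alt))
        changes : ¬ Alternates n
        changes alt = no-odd-alternation n λ t t<L → alternates-below L t (<⇒≤ t<L)
                        (trans (cyc-periodic (suc n)) (trans alt (cong not (sym (cyc-periodic n)))))

      cyc-constant : ∀ n → cyc n ≡ cyc 0
      cyc-constant zero    = refl
      cyc-constant (suc n) = trans (cyc-step n) (cyc-constant n)

    forward? : ∀ n → Dec (ForwardBroom n)
    forward? n = (cyc n ≟ᵇ pen n) ×-dec ((pen (suc n) ≟ᵇ cyc n) ⊎-dec (cyc (suc n) ≟ᵇ cyc n))

    backward? : ∀ n → Dec (BackwardBroom n)
    backward? n = (cyc (suc n) ≟ᵇ pen (2 + n)) ×-dec ((pen (suc n) ≟ᵇ cyc (suc n)) ⊎-dec (cyc n ≟ᵇ cyc (suc n)))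

    private
      Periodic : (ℕ → Bool) → Set
      Periodic f = ∀ n → f (n + L) ≡ f n

      unwind : ∀ {f} → Periodic f → ∀ r q → f (r + q * L) ≡ f r
      unwind {f} per r zero    = cong f (+-identityʳ r)
      unwind {f} per r (suc q) = trans (cong f (sym (trans (+-assoc r (q * L) L) (cong (r +_) (+-comm (q * L) L)))))
                                       (trans (per (r + q * L)) (unwind per r q))

      unshift : ∀ {f g} → Periodic f → Periodic g → ∀ {x y} q → f (x + q * L) ≡ g (y + q * L) → f x ≡ g y
      unshift pf pg {x} {y} q eq = trans (sym (unwind pf x q)) (trans eq (unwind pg y q))

      modL : ∀ n → n ≡ n % L + (n / L) * L
      modL n = m≡m%n+[m/n]*n n L

    forward-mod : ∀ n → ForwardBroom n → ForwardBroom (n % L)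
    forward-mod n fb with subst ForwardBroom (modL n) fb
    ... | c≡p , o = unshift cyc-periodic pen-periodic q c≡p ,
                    Sum.map (unshift pen-periodic cyc-periodic q) (unshift cyc-periodic cyc-periodic q) o
      where q = n / L

    backward-mod : ∀ n → BackwardBroom n → BackwardBroom (n % L)
    backward-mod n bb with subst BackwardBroom (modL n) bb
    ... | c≡p , o = unshift cyc-periodic pen-periodic q c≡p ,
                    Sum.map (unshift pen-periodic cyc-periodic q) (unshift cyc-periodic cyc-periodic q) o
      where q = n / L

    BroomOrMonochromatic : Set
    BroomOrMonochromatic = ∃ ForwardBroom ⊎ ∃ BackwardBroom ⊎ ((∀ n → cyc n ≡ cyc 0) × pen 0 ≡ not (cyc 0))

    broom-or-monochromatic : BroomOrMonochromatic
    broom-or-monochromatic with any? (λ (i : Fin L) → forward? (toℕ i)) | any? (λ (i : Fin L) → backward? (toℕ i))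
    ... | yes (i , fb) | _            = inj₁ (toℕ i , fb)
    ... | no _         | yes (i , bb) = inj₂ (inj₁ (toℕ i , bb))
    ... | no ¬fb       | no ¬bb       = inj₂ (inj₂ (cyc-constant , pen-opposite 0))
      where
      below : ∀ n → toℕ (fromℕ< (m%n<n n L)) ≡ n % L
      below n = toℕ-fromℕ< (m%n<n n L)
      noForward : ∀ n → ¬ ForwardBroom n
      noForward n fb = ¬fb (fromℕ< (m%n<n n L) , subst ForwardBroom (sym (below n)) (forward-mod n fb))
      noBackward : ∀ n → ¬ BackwardBroom n
      noBackward n bb = ¬bb (fromℕ< (m%n<n n L) , subst BackwardBroom (sym (below n)) (backward-mod n bb))
      open WithoutBrooms noForward noBackward

module Modular where

  open import Data.Nat using (suc; _+_; _<_; _≤_; _%_; NonZero; s≤s; z≤n; pred)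
  open import Data.Nat.DivMod using (%-distribˡ-+; m<n⇒m%n≡m; n%n≡0; m%n<n)
  open import Data.Nat.Properties using (+-comm; ≤-antisym; ≮⇒≥; _<?_; <-trans; n<1+n; <-irrefl; ≤-trans; ≤-reflexive)
  open import Data.Empty using (⊥)
  open import Function using (_⟨_⟩_)
  open import Data.Product using (_×_; _,_)
  open import Data.Sum using (_⊎_; inj₁; inj₂)
  open import Relation.Binary.PropositionalEquality
  open import Relation.Nullary using (yes; no)

  suc-mod-suc : ∀ n d .{{_ : NonZero d}} → 1 < d → suc n % d ≡ suc (n % d) % d
  suc-mod-suc n d 1<d = begin
    suc n % d               ≡⟨ cong (_% d) (+-comm 1 n) ⟩
    (n + 1) % d             ≡⟨ %-distribˡ-+ n 1 d ⟩
    (n % d + 1 % d) % d     ≡⟨ cong (λ one → (n % d + one) % d) (m<n⇒m%n≡m 1<d) ⟩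
    (n % d + 1) % d         ≡⟨ cong (_% d) (+-comm (n % d) 1) ⟩
    suc (n % d) % d         ∎
    where open ≡-Reasoning

  suc-mod : ∀ n d .{{_ : NonZero d}} → 1 < d →
            (suc n % d ≡ suc (n % d)) ⊎ (suc n % d ≡ 0 × suc (n % d) ≡ d)
  suc-mod n d 1<d with suc (n % d) <? d
  ... | yes r+1<d = inj₁ (trans (suc-mod-suc n d 1<d) (m<n⇒m%n≡m r+1<d))
  ... | no r+1≮d  = inj₂ (trans (suc-mod-suc n d 1<d) (trans (cong (_% d) r+1≡d) (n%n≡0 d)) , r+1≡d)
    where
    r+1≡d : suc (n % d) ≡ d
    r+1≡d = ≤-antisym (m%n<n n d) (≮⇒≥ r+1≮d)

  private
    r≢2+r : ∀ {r} → r ≢ suc (suc r)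
    r≢2+r {suc r} eq = r≢2+r {r} (cong pred eq)

  mod-2+n : ∀ n d .{{_ : NonZero d}} → 2 < d → n % d ≢ (2 + n) % d
  mod-2+n n d 2<d same = distinct (suc-mod n d 1<d) (suc-mod (suc n) d 1<d)
    where
    1<d : 1 < d
    1<d = <-trans (n<1+n 1) 2<d
    d≢ : ∀ {m} → m ≤ 2 → m ≢ d
    d≢ m≤2 refl = <-irrefl refl (≤-trans 2<d m≤2)
    distinct : _ → _ → ⊥
    distinct (inj₁ s≡) (inj₁ ss≡) = r≢2+r (trans same (trans ss≡ (cong suc s≡)))
    distinct (inj₁ s≡) (inj₂ (ss≡0 , s+1≡d)) =
      d≢ (≤-reflexive (cong suc (trans s≡ (cong suc (trans same ss≡0))))) s+1≡d
    distinct (inj₂ (s≡0 , r+1≡d)) (inj₁ ss≡) =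
      d≢ (≤-reflexive (cong suc (trans same (trans ss≡ (cong suc s≡0))))) r+1≡d
    distinct (inj₂ (s≡0 , _)) (inj₂ (_ , s+1≡d)) = d≢ (≤-reflexive (cong suc s≡0) ⟨ ≤-trans ⟩ s≤s z≤n) s+1≡d

module Tournaments where

  open import Data.Empty using (⊥-elim)
  open import Data.Fin using (Fin; _≟_; toℕ)
  open import Data.Fin.Properties using (any?; all?; ¬∀⟶∃¬; pigeonhole)
  open import Data.Nat using (suc)
  open import Data.Nat.Properties using (≤-refl; <-irrefl)
  open import Data.Product using (∃; _×_; _,_; proj₁; proj₂)
  open import Data.Sum using (_⊎_; inj₁; inj₂)
  open import Function using (_∘_)
  open import Relation.Binary.PropositionalEquality
  open import Relation.Nullary using (¬_; Dec; yes; no; contradiction)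
  open import Relation.Nullary.Decidable using (_×-dec_; _→-dec_; ¬?)

  -- In each of p rounds every ordered pair of the p + 1 players plays a game.
  -- A player who loses all its games in a round is unique, so some player is
  -- never such a loser.
  tournament : ∀ p (win : Fin p → Fin (suc p) → Fin (suc p) → Fin (suc p)) →
               (∀ j a b → win j a b ≡ a ⊎ win j a b ≡ b) →
               ∃ λ d → ∀ j → ∃ λ e → e ≢ d × (win j d e ≡ d ⊎ win j e d ≡ d)
  tournament p win win-plays = d , λ j → wins-in j (never-loser j)
    where
    Loser : Fin p → Fin (suc p) → Set
    Loser j d = ∀ e → e ≢ d → win j d e ≢ d × win j e d ≢ d

    loser? : ∀ j d → Dec (Loser j d)
    loser? j d = all? λ e → ¬? (e ≟ d) →-dec (¬? (win j d e ≟ d) ×-dec ¬? (win j e d ≟ d))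

    loser-unique : ∀ {j d d′} → Loser j d → Loser j d′ → d ≡ d′
    loser-unique {j} {d} {d′} lose lose′ with d ≟ d′
    ... | yes d≡d′ = d≡d′
    ... | no d≢d′ with win-plays j d d′
    ...   | inj₁ d-wins  = contradiction d-wins (proj₁ (lose d′ (d≢d′ ∘ sym)))
    ...   | inj₂ d′-wins = contradiction d′-wins (proj₂ (lose′ d d≢d′))

    champion : ∃ λ d → ∀ j → ¬ Loser j d
    champion with all? (λ d → any? λ j → loser? j d)
    ... | no ¬all = let (d , ¬some) = ¬∀⟶∃¬ (suc p) _ (λ d → any? λ j → loser? j d) ¬all
                    in d , λ j lose → ¬some (j , lose)
    ... | yes all with pigeonhole ≤-refl (λ d → proj₁ (all d))
    ...   | d , d′ , d<d′ , same = ⊥-elim (<-irrefl (cong toℕ d≡d′) d<d′)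
      where
      d≡d′ : d ≡ d′
      d≡d′ = loser-unique (proj₂ (all d)) (subst (λ j → Loser j d′) (sym same) (proj₂ (all d′)))

    d : Fin (suc p)
    d = proj₁ champion

    never-loser : ∀ j → ¬ Loser j d
    never-loser = proj₂ champion

    wins-in : ∀ j → ¬ Loser j d → ∃ λ e → e ≢ d × (win j d e ≡ d ⊎ win j e d ≡ d)
    wins-in j ¬lose with ¬∀⟶∃¬ (suc p) _ (λ e → ¬? (e ≟ d) →-dec (¬? (win j d e ≟ d) ×-dec ¬? (win j e d ≟ d))) ¬lose
    ... | e , ¬lost with e ≟ d | win j d e ≟ d | win j e d ≟ d
    ...   | yes e≡d | _       | _       = contradiction (λ e≢d → contradiction e≡d e≢d) ¬lost
    ...   | no e≢d  | yes won | _       = e , e≢d , inj₁ won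
    ...   | no e≢d  | no _    | yes won = e , e≢d , inj₂ won
    ...   | no e≢d  | no lost | no lost′ = contradiction (λ _ → lost , lost′) ¬lost

-- There is a gadget for every half-length j < p, pair of colours a, b < q and
-- copy t < M; all its edges get the list {a, b}.
module Gadgets (p q M H P₂ : ℕ) where

  open import Defs
  open import Data.Nat using (ℕ; zero; suc; _+_; _*_; _<_; s≤s)
  open import Data.Empty using (⊥)
  open import Data.Fin using (Fin; zero; suc; toℕ; fromℕ<; _≟_)
  open import Data.Fin.Properties using (toℕ-injective; toℕ-fromℕ<; toℕ<n; *↔×; +↔⊎; 1↔⊤)
  open import Data.Nat.Properties using (<⇒≤; <-trans; n<1+n; +-mono-≤; _<?_; 1+n≢n; 0≢1+n)
  import Data.Nat as ℕ
  open import Data.Product using (_×_; _,_; proj₁; proj₂)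
  open import Data.Product.Function.NonDependent.Propositional using (_×-cong_)
  open import Data.Product.Properties using (≡-dec)
  open import Data.Sum using (_⊎_; inj₁; inj₂)
  open import Data.Sum.Function.Propositional using (_⊎-cong_)
  open import Data.Unit using (⊤; tt)
  open import Function.Bundles using (_↔_)
  open import Function.Properties.Inverse using (↔-trans; ↔-refl)
  open import Relation.Binary.PropositionalEquality
  open import Relation.Nullary using (¬_; Dec; no)
  open import Relation.Nullary.Decidable using (_×-dec_; _⊎-dec_; ¬?)

  P₁ : ℕ
  P₁ = suc H + suc H

  Lmax : ℕ
  Lmax = 3 + (p + p)

  Gadget : Set
  Gadget = Fin p × Fin q × Fin q × Fin M

  half : Gadget → ℕ
  half g = toℕ (proj₁ g)

  colA colB : Gadget → Fin q
  colA (_ , a , _) = a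
  colB (_ , _ , b , _) = b

  len : Gadget → ℕ
  len g = 3 + (half g + half g)

  Slot : Set
  Slot = ⊤ ⊎ Fin P₁ ⊎ Fin P₁ × Fin P₂

  pattern onCycle     = inj₁ tt
  pattern pendant s   = inj₂ (inj₁ s)
  pattern leaf    s c = inj₂ (inj₂ (s , c))

  Vertex : Set
  Vertex = Gadget × Fin Lmax × Slot

  private
    _⊗_ : ∀ {a b} {A B : Set} → Fin a ↔ A → Fin b ↔ B → Fin (a * b) ↔ (A × B)
    e ⊗ e′ = ↔-trans *↔× (e ×-cong e′)

    _⊕_ : ∀ {a b} {A B : Set} → Fin a ↔ A → Fin b ↔ B → Fin (a + b) ↔ (A ⊎ B)
    e ⊕ e′ = ↔-trans +↔⊎ (e ⊎-cong e′)

  opaque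
    vertexCount : ℕ
    vertexCount = (p * (q * (q * M))) * (Lmax * (1 + (P₁ + P₁ * P₂)))

    enumeration : Fin vertexCount ↔ Vertex
    enumeration = (↔-refl ⊗ (↔-refl ⊗ (↔-refl ⊗ ↔-refl))) ⊗ (↔-refl ⊗ (1↔⊤ ⊕ (↔-refl ⊕ (↔-refl ⊗ ↔-refl))))

  CycleAdjℕ : ℕ → ℕ → ℕ → Set
  CycleAdjℕ k x y = (y ≡ suc x) ⊎ (x ≡ suc y) ⊎ (x ≡ 0 × y ≡ 2 + (k + k)) ⊎ (y ≡ 0 × x ≡ 2 + (k + k))

  cycleAdjℕ? : ∀ k x y → Dec (CycleAdjℕ k x y)
  cycleAdjℕ? k x y = (y ℕ.≟ suc x) ⊎-dec (x ℕ.≟ suc y) ⊎-dec ((x ℕ.≟ 0) ×-dec (y ℕ.≟ 2 + (k + k)))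
                     ⊎-dec ((y ℕ.≟ 0) ×-dec (x ℕ.≟ 2 + (k + k)))

  CycleAdjℕ-sym : ∀ {k x y} → CycleAdjℕ k x y → CycleAdjℕ k y x
  CycleAdjℕ-sym (inj₁ e)                 = inj₂ (inj₁ e)
  CycleAdjℕ-sym (inj₂ (inj₁ e))          = inj₁ e
  CycleAdjℕ-sym (inj₂ (inj₂ (inj₁ e)))   = inj₂ (inj₂ (inj₂ e))
  CycleAdjℕ-sym (inj₂ (inj₂ (inj₂ e)))   = inj₂ (inj₂ (inj₁ e))

  Local : Gadget → Fin Lmax → Slot → Fin Lmax → Slot → Set
  Local g i onCycle     i′ onCycle      = toℕ i′ < len g × CycleAdjℕ (half g) (toℕ i) (toℕ i′)
  Local g i onCycle     i′ (pendant _)  = i ≡ i′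
  Local g i (pendant _) i′ onCycle      = i ≡ i′
  Local g i (pendant s) i′ (leaf s′ _)  = i ≡ i′ × s ≡ s′
  Local g i (leaf s _)  i′ (pendant s′) = i ≡ i′ × s ≡ s′
  Local g i onCycle     i′ (leaf _ _)   = ⊥
  Local g i (leaf _ _)  i′ onCycle      = ⊥
  Local g i (pendant _) i′ (pendant _)  = ⊥
  Local g i (leaf _ _)  i′ (leaf _ _)   = ⊥

  local? : ∀ g i s i′ s′ → Dec (Local g i s i′ s′)
  local? g i onCycle     i′ onCycle      = (toℕ i′ <? len g) ×-dec cycleAdjℕ? (half g) (toℕ i) (toℕ i′)
  local? g i onCycle     i′ (pendant _)  = i ≟ i′
  local? g i (pendant _) i′ onCycle      = i ≟ i′
  local? g i (pendant s) i′ (leaf s′ _)  = (i ≟ i′) ×-dec (s ≟ s′)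
  local? g i (leaf s _)  i′ (pendant s′) = (i ≟ i′) ×-dec (s ≟ s′)
  local? g i onCycle     i′ (leaf _ _)   = no λ ()
  local? g i (leaf _ _)  i′ onCycle      = no λ ()
  local? g i (pendant _) i′ (pendant _)  = no λ ()
  local? g i (leaf _ _)  i′ (leaf _ _)   = no λ ()

  local-sym : ∀ g i s i′ s′ → toℕ i < len g → Local g i s i′ s′ → toℕ i′ < len g × Local g i′ s′ i s
  local-sym g i onCycle     i′ onCycle      i<len (i′<len , adj) = i′<len , i<len , CycleAdjℕ-sym {half g} adj
  local-sym g i onCycle     i′ (pendant _)  i<len refl           = i<len , refl
  local-sym g i (pendant _) i′ onCycle      i<len refl           = i<len , refl
  local-sym g i (pendant s) i′ (leaf s′ _)  i<len (refl , eq)    = i<len , refl , sym eq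
  local-sym g i (leaf s _)  i′ (pendant s′) i<len (refl , eq)    = i<len , refl , sym eq

  _~_ : Vertex → Vertex → Set
  (g , i , s) ~ (g′ , i′ , s′) = g ≡ g′ × colA g ≢ colB g × toℕ i < len g × Local g i s i′ s′

  _~?_ : ∀ a b → Dec (a ~ b)
  (g , i , s) ~? (g′ , i′ , s′) =
    gadget? g g′ ×-dec ¬? (colA g ≟ colB g) ×-dec (toℕ i <? len g) ×-dec local? g i s i′ s′
    where
    gadget? : (g g′ : Gadget) → Dec (g ≡ g′)
    gadget? = ≡-dec _≟_ (≡-dec _≟_ (≡-dec _≟_ _≟_))

  ~-sym : ∀ {a b} → a ~ b → b ~ a
  ~-sym {g , i , s} {_ , i′ , s′} (refl , valid , i<len , adj) with local-sym g i s i′ s′ i<len adj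
  ... | i′<len , adj′ = refl , valid , i′<len , adj′

  ~-irrefl : ∀ {a} → ¬ a ~ a
  ~-irrefl {_ , _ , onCycle} (_ , _ , _ , _ , inj₁ e)                       = 1+n≢n (sym e)
  ~-irrefl {_ , _ , onCycle} (_ , _ , _ , _ , inj₂ (inj₁ e))                = 1+n≢n (sym e)
  ~-irrefl {_ , _ , onCycle} (_ , _ , _ , _ , inj₂ (inj₂ (inj₁ (e , e′))))  = 0≢1+n (trans (sym e) e′)
  ~-irrefl {_ , _ , onCycle} (_ , _ , _ , _ , inj₂ (inj₂ (inj₂ (e , e′))))  = 0≢1+n (trans (sym e) e′)
  ~-irrefl {_ , _ , pendant _} (_ , _ , _ , ())
  ~-irrefl {_ , _ , leaf _ _}  (_ , _ , _ , ())

  open FiniteGraph enumeration _~_ _~?_ ~-sym ~-irrefl public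

  private
    prevℕ : Gadget → ℕ → ℕ
    prevℕ g zero    = 2 + (half g + half g)
    prevℕ g (suc x) = x

    prevℕ<Lmax : ∀ g x → x < Lmax → prevℕ g x < Lmax
    prevℕ<Lmax g zero    _    = s≤s (s≤s (s≤s (+-mono-≤ (<⇒≤ (toℕ<n (proj₁ g))) (<⇒≤ (toℕ<n (proj₁ g))))))
    prevℕ<Lmax g (suc x) x<L = <-trans (n<1+n x) x<L

    prev : Gadget → Fin Lmax → Fin Lmax
    prev g i = fromℕ< (prevℕ<Lmax g (toℕ i) (toℕ<n i))

    onCycle-at : ∀ g {i i′} → toℕ i ≡ prevℕ g (toℕ i′) → _≡_ {A = Vertex} (g , i , onCycle) (g , prev g i′ , onCycle)
    onCycle-at g {i} {i′} eq = cong (λ j → g , j , onCycle) (toℕ-injective (trans eq (sym (toℕ-fromℕ< _))))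

  parent : Vertex → Vertex
  parent (g , i , onCycle)   = g , prev g i , onCycle
  parent (g , i , pendant s) = g , i , onCycle
  parent (g , i , leaf s _)  = g , i , pendant s

  edge-to-parent : ∀ {a b} → a ~ b → parent a ≡ b ⊎ parent b ≡ a
  edge-to-parent {g , i , onCycle} {_ , i′ , onCycle} (refl , _ , _ , _ , adj) with adj
  ... | inj₁ i′≡1+i                       = inj₂ (sym (onCycle-at g {i} {i′} (sym (cong (prevℕ g) i′≡1+i))))
  ... | inj₂ (inj₁ i≡1+i′)                = inj₁ (sym (onCycle-at g {i′} {i} (sym (cong (prevℕ g) i≡1+i′))))
  ... | inj₂ (inj₂ (inj₁ (i≡0 , i′≡top))) = inj₁ (sym (onCycle-at g {i′} {i} (trans i′≡top (cong (prevℕ g) (sym i≡0)))))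
  ... | inj₂ (inj₂ (inj₂ (i′≡0 , i≡top))) = inj₂ (sym (onCycle-at g {i} {i′} (trans i≡top (cong (prevℕ g) (sym i′≡0)))))
  edge-to-parent {_ , _ , onCycle}   {_ , _ , pendant _} (refl , _ , _ , refl)        = inj₂ refl
  edge-to-parent {_ , _ , pendant _} {_ , _ , onCycle}   (refl , _ , _ , refl)        = inj₁ refl
  edge-to-parent {_ , _ , pendant _} {_ , _ , leaf _ _}  (refl , _ , _ , refl , refl) = inj₂ refl
  edge-to-parent {_ , _ , leaf _ _}  {_ , _ , pendant _} (refl , _ , _ , refl , refl) = inj₁ refl

  gadgets-mAtMost1 : mAtMost1 graph
  gadgets-mAtMost1 = graph-mAtMost1 parent edge-to-parent

  gadgetOf : Vertex → Gadget
  gadgetOf = proj₁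

  palette : Vertex → ℕ × ℕ
  palette (g , _) = toℕ (colA g) , toℕ (colB g)

  palette-distinct : ∀ {a b} → a ~ b → proj₁ (palette a) ≢ proj₂ (palette a)
  palette-distinct (_ , valid , _) = valid ∘ toℕ-injective
    where open import Function using (_∘_)

  palette-edge : ∀ {a b} → a ~ b → palette a ≡ palette b
  palette-edge (refl , _) = refl

  lists : ListAssignment2 graph
  lists = listAssignment palette palette-distinct

module GadgetAnalysis (p q M H P₂ : ℕ) where

  open import Defs
  open import Data.Nat using (ℕ; zero; suc; _+_; _≤_; _<_; z≤n; s≤s; _%_)
  open Gadgets p q M H P₂
  open Counting using (majority; MonochromaticPart)
  open Modular using (suc-mod; mod-2+n)
  open OddCycles using (module OddCycleColouring)
  open import Data.Bool using (Bool; true; false; not) renaming (_≟_ to _≟ᵇ_)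
  open import Data.Bool.Properties using (not-involutive; ¬-not)
  open import Data.Fin using (Fin; zero; suc; toℕ; fromℕ<)
  open import Data.Fin.Properties using (toℕ-injective; toℕ-fromℕ<; toℕ<n; any?; suc-injective; 0≢1+n)
  open import Data.Nat.DivMod using (m%n<n; [m+n]%n≡m%n; m<n⇒m%n≡m)
  open import Data.Nat.Properties using (≤-refl; ≤-trans; +-mono-≤; <⇒≤)
  import Data.Nat as ℕ
  open import Data.Product using (Σ; _×_; _,_; proj₁; proj₂)
  open import Data.Sum using (_⊎_; inj₁; inj₂)
  open import Function using (_∘_)
  open import Relation.Binary.PropositionalEquality
  open import Relation.Nullary using (Dec; yes; no; contradiction)

  InGadget : Gadget → Vertex → Set
  InGadget g a = gadgetOf a ≡ g

  pick : Fin q → Fin q → Bool → Fin q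
  pick a b true  = a
  pick a b false = b

  colourOf : Gadget → Bool → ℕ
  colourOf g β = toℕ (pick (colA g) (colB g) β)

  module Analysis (χ : Fin (e graph) → ℕ) (fromLists : FromLists graph lists χ) where

    open Coloured χ public

    BroomIn CycleIn StarIn : Gadget → ℕ → Set
    BroomIn g c = Copy (InGadget g) c (3 + H) (BroomAdj H)
    CycleIn g c = Copy (InGadget g) c (len g) (CycleAdj (half g))
    StarIn  g c = Copy (InGadget g) c (1 + P₂) (StarAdj P₂)

    Outcome : Gadget → Set
    Outcome g = (Σ Bool λ β → BroomIn g (colourOf g β)) ⊎
                (Σ Bool λ β → CycleIn g (colourOf g β) × StarIn g (colourOf g β))

    module ColouredGadget (g : Gadget) (valid : colA g ≢ colB g) where

      L : ℕ
      L = len g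

      bit : ℕ → Bool
      bit x with x ℕ.≟ toℕ (colA g)
      ... | yes _ = true
      ... | no _  = false

      as-bit : ∀ x → x ≡ toℕ (colA g) ⊎ x ≡ toℕ (colB g) → x ≡ colourOf g (bit x)
      as-bit x inPalette with x ℕ.≟ toℕ (colA g) | inPalette
      ... | yes isA | _        = isA
      ... | no notA | inj₁ isA = contradiction isA notA
      ... | no _    | inj₂ isB = isB

      colour-bit : ∀ {i s b} → (g , i , s) ~ b → colourᵥ (g , i , s) b ≡ colourOf g (bit (colourᵥ (g , i , s) b))
      colour-bit a~b = as-bit _ (colour-in-palette palette palette-distinct palette-edge fromLists a~b)

      at : ℕ → Fin Lmax
      at n = fromℕ< (≤-trans (m%n<n n L) L≤Lmax)
        where
        L≤Lmax : L ≤ Lmax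
        L≤Lmax = s≤s (s≤s (s≤s (+-mono-≤ (<⇒≤ (toℕ<n (proj₁ g))) (<⇒≤ (toℕ<n (proj₁ g))))))

      toℕ-at : ∀ n → toℕ (at n) ≡ n % L
      toℕ-at n = toℕ-fromℕ< _

      at-periodic : ∀ n → at (n + L) ≡ at n
      at-periodic n = toℕ-injective (trans (toℕ-at (n + L)) (trans ([m+n]%n≡m%n n L) (sym (toℕ-at n))))

      cyc : ℕ → Vertex
      cyc n = g , at n , onCycle

      pen : ℕ → Fin P₁ → Vertex
      pen n s = g , at n , pendant s

      lf : ℕ → Fin P₁ → Fin P₂ → Vertex
      lf n s c = g , at n , leaf s c

      at<L : ∀ n → toℕ (at n) < L
      at<L n = subst (_< L) (sym (toℕ-at n)) (m%n<n n L)

      cycle-edge : ∀ n → cyc n ~ cyc (suc n)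
      cycle-edge n = refl , valid , at<L n , at<L (suc n) , adjacent
        where
        adjacent : CycleAdjℕ (half g) (toℕ (at n)) (toℕ (at (suc n)))
        adjacent rewrite toℕ-at n | toℕ-at (suc n) with suc-mod n L (s≤s (s≤s z≤n))
        ... | inj₁ next        = inj₁ next
        ... | inj₂ (wrap , top) = inj₂ (inj₂ (inj₂ (wrap , cong ℕ.pred top)))

      pendant-edge : ∀ n s → cyc n ~ pen n s
      pendant-edge n s = refl , valid , at<L n , refl

      leaf-edge : ∀ n s c → pen n s ~ lf n s c
      leaf-edge n s c = refl , valid , at<L n , refl , refl

      at-suc : ∀ n → at n ≢ at (suc n)
      at-suc n same = ~-irrefl {cyc n} (subst (λ i → cyc n ~ (g , i , onCycle)) (sym same) (cycle-edge n))

      at-2+n : ∀ n → at n ≢ at (2 + n)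
      at-2+n n same = mod-2+n n L (s≤s (s≤s (s≤s z≤n)))
                        (trans (sym (toℕ-at n)) (trans (cong toℕ same) (toℕ-at (2 + n))))

      cycColour : ℕ → Bool
      cycColour n = bit (colourᵥ (cyc n) (cyc (suc n)))

      cycle-colour : ∀ n → colourᵥ (cyc n) (cyc (suc n)) ≡ colourOf g (cycColour n)
      cycle-colour n = colour-bit (cycle-edge n)

      position : Vertex → Fin Lmax
      position (_ , i , _) = i

      pendantIndex : Vertex → Fin P₁
      pendantIndex (_ , _ , pendant s) = s
      pendantIndex (_ , _ , leaf s _)  = s
      pendantIndex (_ , _ , onCycle)   = zero

      leafIndex : Vertex → ℕ
      leafIndex (_ , _ , leaf _ c) = toℕ c
      leafIndex _                  = 0

      majorityAt : (i : Fin Lmax) → MonochromaticPart (λ s → bit (colourᵥ (g , i , onCycle) (g , i , pendant s))) (suc H)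
      majorityAt i = majority (suc H) ≤-refl (λ s → bit (colourᵥ (g , i , onCycle) (g , i , pendant s)))

      penColour : ℕ → Bool
      penColour n = proj₁ (majorityAt (at n))

      major : ℕ → Fin (suc H) → Fin P₁
      major n = proj₁ (proj₁ (proj₂ (majorityAt (at n))))

      major-injective : ∀ n {s s′} → major n s ≡ major n s′ → s ≡ s′
      major-injective n = proj₂ (proj₁ (proj₂ (majorityAt (at n))))

      major-colour : ∀ n s → colourᵥ (cyc n) (pen n (major n s)) ≡ colourOf g (penColour n)
      major-colour n s = trans (colour-bit (pendant-edge n (major n s)))
                               (cong (colourOf g) (proj₂ (proj₂ (majorityAt (at n))) s))

      -- the hairs avoid the pendant major n zero, which may serve as a tip
      hair : ℕ → Fin H → Vertex
      hair n s = pen n (major n (suc s))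

      broomAt : ∀ w β (handle tip : Vertex) → penColour w ≡ β →
                handle ~ cyc w → colourᵥ handle (cyc w) ≡ colourOf g β →
                tip ~ handle → colourᵥ tip handle ≡ colourOf g β →
                InGadget g handle → InGadget g tip → tip ≢ cyc w →
                (∀ s → hair w s ≢ handle) → (∀ s → hair w s ≢ tip) → BroomIn g (colourOf g β)
      broomAt w β handle tip pen≡β h~w h-colour t~h t-colour h-in t-in t≢w hair≢h hair≢t = broom-copy record
        { tip = tip ; handle = handle ; centre = cyc w ; hair = hair w
        ; tip~handle = t~h ; handle~centre = h~w ; centre~hair = λ s → pendant-edge w (major w (suc s))
        ; tip-colour = t-colour ; handle-colour = h-colour
        ; hair-colour = λ s → trans (major-colour w (suc s)) (cong (colourOf g) pen≡β)
        ; tip-in = t-in ; handle-in = h-in ; centre-in = refl ; hair-in = λ _ → refl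
        ; tip≢centre = t≢w
        ; hair-injective = suc-injective ∘ major-injective w ∘ cong pendantIndex
        ; hair≢tip = hair≢t ; hair≢handle = hair≢h }

      backwards : ∀ {a b c} → a ~ b → colourᵥ a b ≡ c → b ~ a × colourᵥ b a ≡ c
      backwards {a} {b} a~b col = ~-sym a~b , trans (colourᵥ-sym b a) col

      open OddCycleColouring (half g) cycColour penColour
             (λ n → cong₂ (λ i j → bit (colourᵥ (g , i , onCycle) (g , j , onCycle))) (at-periodic n) (at-periodic (suc n)))
             (λ n → cong (proj₁ ∘ majorityAt) (at-periodic n))
        using (ForwardBroom; BackwardBroom; BroomOrMonochromatic; broom-or-monochromatic)

      spare : ℕ → Vertex
      spare n = pen n (major n zero)

      spare-edge : ∀ n → spare n ~ cyc n × colourᵥ (spare n) (cyc n) ≡ colourOf g (penColour n)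
      spare-edge n = backwards (pendant-edge n (major n zero)) (major-colour n zero)

      forwardBroom : ∀ n → ForwardBroom n → BroomIn g (colourOf g (cycColour n))
      forwardBroom n (c≡p , inj₁ p≡c) =
        broomAt n _ (cyc (suc n)) (spare (suc n)) (sym c≡p)
          (proj₁ (backwards (cycle-edge n) (cycle-colour n))) (proj₂ (backwards (cycle-edge n) (cycle-colour n)))
          (proj₁ (spare-edge (suc n))) (trans (proj₂ (spare-edge (suc n))) (cong (colourOf g) p≡c))
          refl refl (λ ()) (λ _ ()) (λ _ → at-suc n ∘ cong position)
      forwardBroom n (c≡p , inj₂ c≡c) =
        broomAt n _ (cyc (suc n)) (cyc (2 + n)) (sym c≡p)
          (proj₁ (backwards (cycle-edge n) (cycle-colour n))) (proj₂ (backwards (cycle-edge n) (cycle-colour n)))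
          (proj₁ (backwards (cycle-edge (suc n)) (cycle-colour (suc n))))
          (trans (proj₂ (backwards (cycle-edge (suc n)) (cycle-colour (suc n)))) (cong (colourOf g) c≡c))
          refl refl (at-2+n n ∘ sym ∘ cong position) (λ _ ()) (λ _ ())

      backwardBroom : ∀ n → BackwardBroom n → BroomIn g (colourOf g (cycColour (suc n)))
      backwardBroom n (c≡p , inj₁ p≡c) =
        broomAt (2 + n) _ (cyc (suc n)) (spare (suc n)) (sym c≡p) (cycle-edge (suc n)) (cycle-colour (suc n))
          (proj₁ (spare-edge (suc n))) (trans (proj₂ (spare-edge (suc n))) (cong (colourOf g) p≡c))
          refl refl (λ ()) (λ _ ()) (λ _ → at-suc (suc n) ∘ sym ∘ cong position)
      backwardBroom n (c≡p , inj₂ c≡c) =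
        broomAt (2 + n) _ (cyc (suc n)) (cyc n) (sym c≡p) (cycle-edge (suc n)) (cycle-colour (suc n))
          (cycle-edge n) (trans (cycle-colour n) (cong (colourOf g) c≡c))
          refl refl (at-2+n n ∘ cong position) (λ _ ()) (λ _ ())

      -- A monochromatic cycle whose pendant majorities have the other colour: the
      -- leaves of the spare pendant at 0 either extend it to a broom or form a
      -- star in the colour of the cycle.
      leafBit : Fin P₂ → Bool
      leafBit c = bit (colourᵥ (spare 0) (lf 0 (major 0 zero) c))

      structure : (∀ n → cycColour n ≡ cycColour 0) → penColour 0 ≡ not (cycColour 0) →
                  Dec (Σ (Fin P₂) λ c → leafBit c ≡ penColour 0) → Outcome g
      structure constant opposite (yes (c , same)) =
        inj₁ (penColour 0 , broomAt 0 _ (spare 0) (lf 0 (major 0 zero) c) refl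
                              (proj₁ (spare-edge 0)) (proj₂ (spare-edge 0))
                              (proj₁ tip-edge) (trans (proj₂ tip-edge) (cong (colourOf g) same))
                              refl refl (λ ()) hair≢spare (λ _ ()))
        where
        tip-edge : lf 0 (major 0 zero) c ~ spare 0 × colourᵥ (lf 0 (major 0 zero) c) (spare 0) ≡ colourOf g (leafBit c)
        tip-edge = backwards (leaf-edge 0 (major 0 zero) c) (colour-bit (leaf-edge 0 (major 0 zero) c))
        hair≢spare : ∀ s → hair 0 s ≢ spare 0
        hair≢spare s eq = 0≢1+n (sym (major-injective 0 (cong pendantIndex eq)))
      structure constant opposite (no different) =
        inj₂ (cycColour 0 , cycle , star)
        where
        ℓ : Fin P₁
        ℓ = major 0 zero
        leaf-colour : ∀ c → colourᵥ (spare 0) (lf 0 ℓ c) ≡ colourOf g (cycColour 0)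
        leaf-colour c = trans (colour-bit (leaf-edge 0 ℓ c))
                              (cong (colourOf g) (trans (¬-not λ same → different (c , same))
                                                        (trans (cong not opposite) (not-involutive _))))
        star : StarIn g (colourOf g (cycColour 0))
        star = star-copy {P = InGadget g} (spare 0) (lf 0 ℓ) (toℕ-injective ∘ cong leafIndex) (leaf-edge 0 ℓ) leaf-colour refl (λ _ → refl)
        cyc-injective : ∀ {x y} → x < L → y < L → cyc x ≡ cyc y → x ≡ y
        cyc-injective {x} {y} x<L y<L eq = begin
          x                 ≡⟨ sym (m<n⇒m%n≡m x<L) ⟩
          x % L             ≡⟨ sym (toℕ-at x) ⟩
          toℕ (at x)        ≡⟨ cong (toℕ ∘ position) eq ⟩
          toℕ (at y)        ≡⟨ toℕ-at y ⟩
          y % L             ≡⟨ m<n⇒m%n≡m y<L ⟩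
          y                 ∎
          where open ≡-Reasoning
        cycle : CycleIn g (colourOf g (cycColour 0))
        cycle = cycle-copy {P = InGadget g} (half g) cyc (λ n → cong (λ i → g , i , onCycle) (at-periodic n)) cyc-injective
                  cycle-edge (λ n → trans (cycle-colour n) (cong (colourOf g) (constant n))) (λ _ → refl)

      outcome : Outcome g
      outcome = classify broom-or-monochromatic
        where
        classify : BroomOrMonochromatic → Outcome g
        classify (inj₁ (n , fb))                     = inj₁ (cycColour n , forwardBroom n fb)
        classify (inj₂ (inj₁ (n , bb)))              = inj₁ (cycColour (suc n) , backwardBroom n bb)
        classify (inj₂ (inj₂ (constant , opposite))) =
          structure constant opposite (any? λ c → leafBit c ≟ᵇ penColour 0)

module Construction (B C : Graph) (B-brooms : BGraph B) (C-cyclesStars : CStarGraph C) where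

  open Counting using (Injects; majority²; sumᶠ; ≤-sumᶠ)
  open Reachability using (ComponentEmbeds-∘)
  open Tournaments using (tournament)
  open import Data.Bool using (Bool; true; false) renaming (_≟_ to _≟ᵇ_)
  open import Data.Bool.Properties using (¬-not)
  open import Data.Empty using (⊥-elim)
  open import Data.Fin using (Fin; zero; suc; toℕ; fromℕ<; inject≤; _≟_; _↑ˡ_; _↑ʳ_)
  open import Data.Fin.Properties using (any?; toℕ-fromℕ<; toℕ-inject≤; inject≤-injective; ↑ˡ-injective; ↑ʳ-injective)
  open import Data.Nat using (ℕ; zero; suc; _+_; _≤_; s≤s)
  open import Data.Nat.Properties using (n≤1+n; +-monoʳ-≤)
  open import Data.Product using (Σ; ∃; _×_; _,_; proj₁; proj₂)
  open import Data.Sum using (_⊎_; inj₁; inj₂)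
  open import Function using (_∘_)
  open import Function.Definitions using (Injective)
  open import Relation.Binary.PropositionalEquality
  open import Relation.Nullary using (Dec; yes; no)

  r : ℕ
  r = n B + n C

  hairs : Fin (n B) → ℕ
  hairs x = proj₁ (B-brooms x)

  CycleOrStar : Fin (n C) → Set
  CycleOrStar x = (∃ λ k → ComponentEmbeds C x (3 + (k + k)) (CycleAdj k)) ⊎
                  (∃ λ k → ComponentEmbeds C x (1 + k) (StarAdj k))

  halfSize starSize : ∀ {x} → CycleOrStar x → ℕ
  halfSize (inj₁ (k , _)) = k
  halfSize (inj₂ _)       = 0
  starSize (inj₁ _)       = 0
  starSize (inj₂ (k , _)) = k

  p q M H P₂ : ℕ
  p  = suc (sumᶠ (halfSize ∘ C-cyclesStars))
  q  = suc p
  M  = suc ((r + r) + (r + r))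
  H  = sumᶠ hairs
  P₂ = sumᶠ (starSize ∘ C-cyclesStars)

  open Gadgets p q M H P₂ public
  open GadgetAnalysis p q M H P₂ public

  someVertex : Vertex
  someVertex = (zero , zero , zero , zero) , zero , onCycle

  -- BroomAdj h u v and StarAdj h u v are these relations between toℕ u and toℕ v,
  -- whatever h is.
  private
    BroomAdjℕ : ℕ → ℕ → Set
    BroomAdjℕ x y = (x ≡ 0 × y ≡ 1) ⊎ (x ≡ 1 × y ≡ 0) ⊎ (x ≡ 1 × y ≡ 2) ⊎ (x ≡ 2 × y ≡ 1) ⊎
                    (x ≡ 2 × 3 ≤ y) ⊎ (3 ≤ x × y ≡ 2)

    StarAdjℕ : ℕ → ℕ → Set
    StarAdjℕ x y = (x ≡ 0 × y ≢ 0) ⊎ (y ≡ 0 × x ≢ 0)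

  widen : ∀ {G x m m′} (Aℕ : ℕ → ℕ → Set) → m ≤ m′ →
          ComponentEmbeds G x m (λ u v → Aℕ (toℕ u) (toℕ v)) → ComponentEmbeds G x m′ (λ u v → Aℕ (toℕ u) (toℕ v))
  widen Aℕ m≤m′ emb =
    ComponentEmbeds-∘ {A′ = λ u v → Aℕ (toℕ u) (toℕ v)} emb (λ u → inject≤ u m≤m′) (inject≤-injective m≤m′ m≤m′ _ _)
      λ {u} {v} → subst₂ Aℕ (sym (toℕ-inject≤ u m≤m′)) (sym (toℕ-inject≤ v m≤m′))

  module Colouring (χ : Fin (e graph) → ℕ) (fromLists : FromLists graph lists χ) where

    open Analysis χ fromLists

    gadget : Fin p → Fin q → Fin q → Fin M → Gadget
    gadget j a b t = j , a , b , t

    copyOf : Gadget → Fin M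
    copyOf (_ , _ , _ , t) = t

    Brooms Structures : Fin p → Fin q → Fin q → ℕ → Set
    Brooms     j a b c = Σ (Injects r M) λ ι → ∀ s → BroomIn (gadget j a b (proj₁ ι s)) c
    Structures j a b c = Σ (Injects r M) λ ι → ∀ s → CycleIn (gadget j a b (proj₁ ι s)) c ×
                                                      StarIn (gadget j a b (proj₁ ι s)) c

    private
      isBroom bitOf : ∀ {g} → Outcome g → Bool
      isBroom (inj₁ _) = true
      isBroom (inj₂ _) = false
      bitOf (inj₁ (β , _)) = β
      bitOf (inj₂ (β , _)) = β

      broomOf : ∀ {g β} (o : Outcome g) → isBroom o ≡ true × bitOf o ≡ β → BroomIn g (colourOf g β)
      broomOf (inj₁ (_ , broom)) (_ , refl) = broom

      structureOf : ∀ {g β} (o : Outcome g) → isBroom o ≡ false × bitOf o ≡ β →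
                    CycleIn g (colourOf g β) × StarIn g (colourOf g β)
      structureOf (inj₂ (_ , structure)) (_ , refl) = structure

    Kind : Fin p → Fin q → Fin q → Set
    Kind j a b = (Σ Bool λ β → Brooms j a b (toℕ (pick a b β))) ⊎ (Σ Bool λ β → Structures j a b (toℕ (pick a b β)))

    -- Among the M ≥ 4r copies, r have the same kind of outcome in the same colour.
    kind : ∀ j a b → a ≢ b → Kind j a b
    kind j a b a≢b = choose (majority² r (n≤1+n _) (isBroom ∘ outcomeAt) (bitOf ∘ outcomeAt))
      where
      outcomeAt : ∀ t → Outcome (gadget j a b t)
      outcomeAt t = ColouredGadget.outcome (gadget j a b t) a≢b
      choose : (Σ Bool λ κ → Σ Bool λ β → Σ (Injects r M) λ (ι , _) → ∀ s → isBroom (outcomeAt (ι s)) ≡ κ × bitOf (outcomeAt (ι s)) ≡ β) → Kind j a b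
      choose (true  , β , ι , same) = inj₁ (β , ι , λ s → broomOf (outcomeAt _) (same s))
      choose (false , β , ι , same) = inj₂ (β , ι , λ s → structureOf (outcomeAt _) (same s))

    copy-injective : ∀ {j a b} (ι : Injects r M) {s s′} → gadget j a b (proj₁ ι s) ≡ gadget j a b (proj₁ ι s′) → s ≡ s′
    copy-injective (_ , ι-inj) = ι-inj ∘ cong copyOf

    copy-B : ∀ {j a b c} → Brooms j a b c → MonoCopy graph χ c B
    copy-B {j} {a} {b} {c} (ι , brooms) = assemble B c gadgetOf γ γ-injective component
      where
      γ : Fin (n B) → Gadget
      γ x = gadget j a b (proj₁ ι (x ↑ˡ n C))
      γ-injective : Injective _≡_ _≡_ γ
      γ-injective {x} {x′} = ↑ˡ-injective (n C) x x′ ∘ copy-injective ι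
      component : ∀ x → ComponentCopy B x (InGadget (γ x)) c
      component x = copy-component {P = InGadget (γ x)} (widen BroomAdjℕ (+-monoʳ-≤ 3 (≤-sumᶠ hairs x)) (proj₂ (B-brooms x)))
                                   (brooms (x ↑ˡ n C))

    module CopyC (d : Fin q) (structures : ∀ j → Σ (Fin q) λ a → Σ (Fin q) λ b → Structures j a b (toℕ d)) where

      colourA colourB : Fin p → Fin q
      colourA j = proj₁ (structures j)
      colourB j = proj₁ (proj₂ (structures j))

      copies : Fin p → Injects r M
      copies j = proj₁ (proj₂ (proj₂ (structures j)))

      halfOf : Fin (n C) → Fin p
      halfOf x = fromℕ< (s≤s (≤-sumᶠ (halfSize ∘ C-cyclesStars) x))

      γ : Fin (n C) → Gadget
      γ x = gadget (halfOf x) (colourA (halfOf x)) (colourB (halfOf x)) (proj₁ (copies (halfOf x)) (n B ↑ʳ x))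

      γ-injective : Injective _≡_ _≡_ γ
      γ-injective {x} {x′} eq = ↑ʳ-injective (n B) x x′ (proj₂ (copies (halfOf x)) same-copy)
        where
        same-copy : proj₁ (copies (halfOf x)) (n B ↑ʳ x) ≡ proj₁ (copies (halfOf x)) (n B ↑ʳ x′)
        same-copy = trans (cong copyOf eq) (cong (λ j → proj₁ (copies j) (n B ↑ʳ x′)) (sym (cong proj₁ eq)))

      component-from : ∀ {g x} (w : CycleOrStar x) → half g ≡ halfSize w → starSize w ≤ P₂ →
                       CycleIn g (toℕ d) × StarIn g (toℕ d) → ComponentCopy C x (InGadget g) (toℕ d)
      component-from {g} (inj₁ (k , emb)) half≡k _ (cycle , _) =
        copy-component {P = InGadget g} emb (subst (λ k → Copy (InGadget g) (toℕ d) (3 + (k + k)) (CycleAdj k)) half≡k cycle)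
      component-from {g} (inj₂ (k , emb)) _ k≤P₂ (_ , star) =
        copy-component {P = InGadget g} (widen StarAdjℕ (s≤s k≤P₂) emb) star

      copy-C : MonoCopy graph χ (toℕ d) C
      copy-C = assemble C (toℕ d) gadgetOf γ γ-injective λ x →
        component-from (C-cyclesStars x) (toℕ-fromℕ< _) (≤-sumᶠ (starSize ∘ C-cyclesStars) x)
                       (proj₂ (proj₂ (proj₂ (structures (halfOf x)))) (n B ↑ʳ x))

    Classified : Fin p → Fin q → Fin q → Set
    Classified j a b = a ≡ b ⊎ Kind j a b

    classified : ∀ j a b → Classified j a b
    classified j a b = byEquality (a ≟ b)
      where
      byEquality : Dec (a ≡ b) → Classified j a b
      byEquality (yes a≡b) = inj₁ a≡b
      byEquality (no a≢b)  = inj₂ (kind j a b a≢b)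

    hasBrooms : ∀ {j a b} → Classified j a b → Bool
    hasBrooms (inj₂ (inj₁ _)) = true
    hasBrooms _               = false

    -- the colour of the structures, or an arbitrary player of the game
    winner : ∀ {j a b} → Classified j a b → Fin q
    winner {a = a} {b} (inj₂ (inj₂ (β , _))) = pick a b β
    winner {a = a}     _                      = a

    winner-plays : ∀ {j a b} (k : Classified j a b) → winner k ≡ a ⊎ winner k ≡ b
    winner-plays (inj₁ _)                  = inj₁ refl
    winner-plays (inj₂ (inj₁ _))           = inj₁ refl
    winner-plays (inj₂ (inj₂ (true , _)))  = inj₁ refl
    winner-plays (inj₂ (inj₂ (false , _))) = inj₂ refl

    broomsOf : ∀ {j a b} (k : Classified j a b) → hasBrooms k ≡ true → ∃ (Brooms j a b)
    broomsOf (inj₂ (inj₁ (_ , brooms))) _ = _ , brooms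

    structuresOf : ∀ {j a b} (k : Classified j a b) → a ≢ b → hasBrooms k ≡ false → Structures j a b (toℕ (winner k))
    structuresOf (inj₁ a≡b)                  a≢b _ = ⊥-elim (a≢b a≡b)
    structuresOf (inj₂ (inj₂ (_ , structures))) _ _ = structures

    -- If no pair of colours yields brooms, the colours play the tournament in
    -- which a pair is won by the colour of its structures.
    copy-B-or-C : (∃ λ c → MonoCopy graph χ c B) ⊎ (∃ λ c → MonoCopy graph χ c C)
    copy-B-or-C = decide (any? λ j → any? λ a → any? λ b → hasBrooms (classified j a b) ≟ᵇ true)
      where
      decide : Dec (∃ λ j → ∃ λ a → ∃ λ b → hasBrooms (classified j a b) ≡ true) →
               (∃ λ c → MonoCopy graph χ c B) ⊎ (∃ λ c → MonoCopy graph χ c C)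
      decide (yes (j , a , b , has)) = inj₁ (proj₁ (broomsOf (classified j a b) has) , copy-B (proj₂ (broomsOf (classified j a b) has)))
      decide (no none) = inj₂ (toℕ d , CopyC.copy-C d structures)
        where
        noBrooms : ∀ j a b → hasBrooms (classified j a b) ≡ false
        noBrooms j a b = ¬-not λ has → none (j , a , b , has)
        champion : ∃ λ d → ∀ j → ∃ λ e → e ≢ d × (winner (classified j d e) ≡ d ⊎ winner (classified j e d) ≡ d)
        champion = tournament p (λ j a b → winner (classified j a b)) (λ j a b → winner-plays (classified j a b))
        d : Fin q
        d = proj₁ champion
        structures : ∀ j → Σ (Fin q) λ a → Σ (Fin q) λ b → Structures j a b (toℕ d)
        structures j = fromGame (proj₂ champion j)
          where
          fromGame : (∃ λ e → e ≢ d × (winner (classified j d e) ≡ d ⊎ winner (classified j e d) ≡ d)) →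
                     Σ (Fin q) λ a → Σ (Fin q) λ b → Structures j a b (toℕ d)
          fromGame (e , e≢d , inj₁ won) =
            d , e , subst (Structures j d e ∘ toℕ) won (structuresOf (classified j d e) (e≢d ∘ sym) (noBrooms j d e))
          fromGame (e , e≢d , inj₂ won) =
            e , d , subst (Structures j e d ∘ toℕ) won (structuresOf (classified j e d) e≢d (noBrooms j e d))

mainTheorem12 : (𝓕 : Graph → Set) →
    Σ Graph (λ B → 𝓕 B × BGraph B) →
    Σ Graph (λ C → 𝓕 C × CStarGraph C) →
    Σ Graph (λ G → (1 ≤ n G) × mAtMost1 G × ListRamsey2 G 𝓕)
mainTheorem12 𝓕 (B , B∈𝓕 , B-brooms) (C , C∈𝓕 , C-cyclesStars) =
  graph , 1≤n-graph someVertex , gadgets-mAtMost1 , lists , monochromatic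
  where
  open Construction B C B-brooms C-cyclesStars
  monochromatic : ∀ χ → FromLists graph lists χ → Σ Graph λ H → 𝓕 H × ∃ λ c → MonoCopy graph χ c H
  monochromatic χ fromLists = [ member B∈𝓕 , member C∈𝓕 ] (Colouring.copy-B-or-C χ fromLists)
    where
    member : ∀ {H} → 𝓕 H → (∃ λ c → MonoCopy graph χ c H) → Σ Graph λ H′ → 𝓕 H′ × ∃ λ c → MonoCopy graph χ c H′
    member H∈𝓕 copy = _ , H∈𝓕 , copy
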